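{- Let $p$ be a prime, $k\geq 1$, and $K=\mathbb{F}_{p^k}$. Let $m\geq 1$ be an integer such that $K$ contains all $m$th roots of unity (i.e. $m\mid p^k-1$), and put $d=(p^k-1)/m$. Assume that $m\neq 1$ and $(m,k)\neq(2,1)$. Then for every integer $n>d$, the equation $x_1^d+\cdots+x_n^d=0$ has a solution $(x_1,\dots,x_n)\in K^n$ with $x_i\neq 0$ for every $i$. In other words, the weight set $W_p(m)$ contains every integer $n\geq d+1$.
   Context: For a prime $p$ and a positive integer $m$, $W_p(m)$ denotes the set of integers $n\geq 0$ for which there exist $\alpha_1,\dots,\alpha_n$ in the algebraic closure $\overline{\mathbb{F}}_p$ with $\alpha_i^m=1$ for all $i$ (repetitions allowed) and $\alpha_1+\cdots+\alpha_n=0$ (the empty sum gives $0\in W_p(m)$). -}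

module Defs where

open import Level using (Level)
open import Data.Nat using (ℕ)
open import Data.Fin using (Fin)
open import Data.Product using (∃; _×_)
open import Relation.Nullary using (¬_)
open import Relation.Binary.PropositionalEquality using (setoid)
open import Function.Bundles using (Bijection)
open import Algebra.Bundles using (CommutativeRing; Semiring)
import Algebra.Definitions.RawSemiring as RawSemiringDefs

IsField : ∀ {c ℓ} → CommutativeRing c ℓ → Set (c Level.⊔ ℓ)
IsField R = ¬ (1# ≈ 0#) × (∀ x → ¬ (x ≈ 0#) → ∃ λ y → x * y ≈ 1#)
  where open CommutativeRing R

HasCard : ∀ {c ℓ} → CommutativeRing c ℓ → ℕ → Set (c Level.⊔ ℓ)
HasCard R q = Bijection (CommutativeRing.setoid R) (setoid (Fin q))

module FieldOps {c ℓ} (R : CommutativeRing c ℓ) where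
  open CommutativeRing R public
  open RawSemiringDefs (Semiring.rawSemiring semiring) public using (_^_; sum)

powSum : ∀ {c ℓ} (R : CommutativeRing c ℓ) {n : ℕ} →
         (Fin n → CommutativeRing.Carrier R) → ℕ → CommutativeRing.Carrier R
powSum R x d = sum (λ i → x i ^ d)
  where open FieldOps R

{-# OPTIONS --safe #-}
-- Let H ⊆ K× be the group of nonzero d-th powers and Sums j the set of sums of j elements of H;
-- we need 0 ∈ Sums n. Each Sums j is stable under multiplication by H, so ∣Sums j ∖ {0}∣ is a
-- multiple of ∣H∣ ≥ m. Suppose some g ∈ H has g² ≠ 1. If ∣Sums (j + 1) ∖ {0}∣ does not exceed
-- ∣Sums j ∖ {0}∣ by ∣H∣, then Sums (j + 1) is Sums j + 1 plus at most one point e, and since ∑ x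
-- and ∑ x² vanish over sets stable under g, e = 1. Hence every 1 - h (h ∈ H) is a period of
-- Sums (j + 1); the periods form an additive group closed under multiplication by 1 - g, so they
-- contain 1 and all of H, and then Sums (j + 1) contains 0 and equals every later Sums.
-- Growth by ∣H∣ cannot go on for n steps, as n ∣H∣ ≥ n m > m d = ∣K×∣. If instead H = {±1}, then
-- m = 2, so k ≥ 2, the characteristic p is odd and p ≤ d, and n > d is even or p plus an even number.
module Submission where

open import Level using (0ℓ)
open import Data.Nat as ℕ using (ℕ; zero; suc)
import Data.Nat.Properties as ℕP
open import Data.Nat.Divisibility using (_∣_; divides; _∣0; ∣m∣n⇒∣m+n; ∣-refl)
open import Data.Nat.Primality using (Prime; prime⇒irreducible; prime⇒nonTrivial; prime⇒nonZero)
open import Data.Integer as ℤ using (ℤ)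
import Data.Integer.Properties as ℤP
open import Data.Sign as Sign using (Sign)
open import Data.Bool as Bool using (Bool; true; false; _∧_; _∨_; not; if_then_else_)
import Data.Bool.Properties as BoolP
open import Data.Fin as Fin using (Fin; toℕ)
import Data.Fin.Properties as FinP
open import Data.Fin.Permutation using (permutation)
open import Data.Maybe using (Maybe; just; nothing)
open import Data.Product using (∃; _×_; _,_; proj₁; proj₂)
open import Data.Sum using (_⊎_; inj₁; inj₂; [_,_]′)
open import Data.Empty using (⊥-elim)
open import Function using (_∘_)
open import Function.Bundles using (Inverse)
open import Function.Properties.Bijection using (Bijection⇒Inverse)
open import Relation.Nullary using (¬_; does; yes; no)
open import Relation.Nullary.Decidable using (dec-true; dec-false; _×-dec_; ¬?; decidable-stable)
open import Relation.Binary.PropositionalEquality as ≡ using (_≡_; _≢_)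
open import Algebra.Bundles using (CommutativeRing; RawRing; Semiring)
open import Algebra.Structures using (IsCommutativeRing)
open import Algebra.Morphism.Structures using (IsRingMonomorphism)
import Algebra.Morphism.RingMonomorphism as RingMonomorphism
import Algebra.Properties.CommutativeMonoid.Sum as CommutativeMonoidSum
open import Defs

-- Algebra.Solver.Ring compares normal forms by refl, so their coefficients must compute; in an
-- arbitrary commutative ring this works with coefficients in ℤ, mapped into R by its canonical
-- homomorphism.
module IntegerCoefficientRingSolver {c ℓ} (R : CommutativeRing c ℓ) where

  open import Data.Integer using (+_; -[1+_]; _⊖_)
  open CommutativeRing R
  open import Algebra.Properties.Ring ring
    using (-‿distribˡ-*; -‿distribʳ-*; -‿involutive; -0#≈0#; -‿anti-homo-+)
  import Algebra.Properties.Monoid.Mult.TCOptimised as MonoidMult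
  import Algebra.Properties.Semiring.Mult.TCOptimised as SemiringMult
  open import Algebra.Solver.Ring.AlmostCommutativeRing
    using (fromCommutativeRing; _-Raw-AlmostCommutative⟶_)
  open import Relation.Binary.Reasoning.Setoid setoid

  fromℕ : ℕ → Carrier
  fromℕ n = MonoidMult._×_ +-monoid n 1#

  fromℕ-+ : ∀ m n → fromℕ (m ℕ.+ n) ≈ fromℕ m + fromℕ n
  fromℕ-+ m n = MonoidMult.×-homo-+ +-monoid 1# m n

  fromℕ-* : ∀ m n → fromℕ (m ℕ.* n) ≈ fromℕ m * fromℕ n
  fromℕ-* = SemiringMult.×1-homo-* semiring

  fromℤ : ℤ → Carrier
  fromℤ (+ n)      = fromℕ n
  fromℤ -[1+ n ]   = - fromℕ (suc n)

  private
    signed : Sign → Carrier → Carrier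
    signed Sign.+ x = x
    signed Sign.- x = - x

    signed-cong : ∀ s {x y} → x ≈ y → signed s x ≈ signed s y
    signed-cong Sign.+ e = e
    signed-cong Sign.- e = -‿cong e

    signed-* : ∀ s t x y → signed (s Sign.* t) (x * y) ≈ signed s x * signed t y
    signed-* Sign.+ Sign.+ x y = refl
    signed-* Sign.+ Sign.- x y = -‿distribʳ-* x y
    signed-* Sign.- Sign.+ x y = -‿distribˡ-* x y
    signed-* Sign.- Sign.- x y = begin
      x * y            ≈⟨ -‿involutive _ ⟨
      - - (x * y)      ≈⟨ -‿cong (-‿distribʳ-* x y) ⟩
      - (x * - y)      ≈⟨ -‿distribˡ-* x (- y) ⟩
      - x * - y        ∎

    fromℤ-sign : ∀ i → fromℤ i ≈ signed (ℤ.sign i) (fromℕ ℤ.∣ i ∣)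
    fromℤ-sign (+ zero)  = refl
    fromℤ-sign (+ suc n) = refl
    fromℤ-sign -[1+ n ]  = refl

    fromℤ-◃ : ∀ s n → fromℤ (s ℤ.◃ n) ≈ signed s (fromℕ n)
    fromℤ-◃ Sign.+ zero    = refl
    fromℤ-◃ Sign.- zero    = sym -0#≈0#
    fromℤ-◃ Sign.+ (suc n) = refl
    fromℤ-◃ Sign.- (suc n) = refl

    [1+a]-[1+b]≈a-b : ∀ a b → (1# + a) - (1# + b) ≈ a - b
    [1+a]-[1+b]≈a-b a b = begin
      (1# + a) + - (1# + b)    ≈⟨ +-congˡ (-‿anti-homo-+ 1# b) ⟩
      (1# + a) + (- b + - 1#)  ≈⟨ +-assoc 1# a _ ⟩
      1# + (a + (- b + - 1#))  ≈⟨ +-congˡ (+-assoc a (- b) (- 1#)) ⟨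
      1# + ((a - b) + - 1#)    ≈⟨ +-congˡ (+-comm _ _) ⟩
      1# + (- 1# + (a - b))    ≈⟨ +-assoc _ _ _ ⟨
      (1# - 1#) + (a - b)      ≈⟨ +-congʳ (-‿inverseʳ 1#) ⟩
      0# + (a - b)             ≈⟨ +-identityˡ _ ⟩
      a - b                    ∎

    fromℤ-⊖ : ∀ m n → fromℤ (m ⊖ n) ≈ fromℕ m - fromℕ n
    fromℤ-⊖ m       zero    = sym (trans (+-congˡ -0#≈0#) (+-identityʳ _))
    fromℤ-⊖ zero    (suc n) = sym (+-identityˡ _)
    fromℤ-⊖ (suc m) (suc n) rewrite ℤP.[1+m]⊖[1+n]≡m⊖n m n = begin
      fromℤ (m ⊖ n)                       ≈⟨ fromℤ-⊖ m n ⟩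
      fromℕ m - fromℕ n                   ≈⟨ [1+a]-[1+b]≈a-b _ _ ⟨
      (1# + fromℕ m) - (1# + fromℕ n)     ≈⟨ +-cong (fromℕ-+ 1 m) (-‿cong (fromℕ-+ 1 n)) ⟨
      fromℕ (suc m) - fromℕ (suc n)       ∎

  fromℤ-+ : ∀ i j → fromℤ (i ℤ.+ j) ≈ fromℤ i + fromℤ j
  fromℤ-+ (+ m)    (+ n)    = fromℕ-+ m n
  fromℤ-+ (+ m)    -[1+ n ] = fromℤ-⊖ m (suc n)
  fromℤ-+ -[1+ m ] (+ n)    = trans (fromℤ-⊖ n (suc m)) (+-comm _ _)
  fromℤ-+ -[1+ m ] -[1+ n ] = begin
    - fromℕ (suc (suc (m ℕ.+ n)))       ≡⟨ ≡.cong (λ k → - fromℕ (suc k)) (ℕP.+-suc m n) ⟨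
    - fromℕ (suc m ℕ.+ suc n)           ≈⟨ -‿cong (fromℕ-+ (suc m) (suc n)) ⟩
    - (fromℕ (suc m) + fromℕ (suc n))   ≈⟨ -‿anti-homo-+ _ _ ⟩
    - fromℕ (suc n) + - fromℕ (suc m)   ≈⟨ +-comm _ _ ⟩
    - fromℕ (suc m) + - fromℕ (suc n)   ∎

  fromℤ-* : ∀ i j → fromℤ (i ℤ.* j) ≈ fromℤ i * fromℤ j
  fromℤ-* i j = begin
    fromℤ (i ℤ.* j)                                   ≈⟨ fromℤ-◃ (s Sign.* t) (ℤ.∣ i ∣ ℕ.* ℤ.∣ j ∣) ⟩
    signed (s Sign.* t) (fromℕ (ℤ.∣ i ∣ ℕ.* ℤ.∣ j ∣))
      ≈⟨ signed-cong (s Sign.* t) (fromℕ-* ℤ.∣ i ∣ ℤ.∣ j ∣) ⟩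
    signed (s Sign.* t) (fromℕ ℤ.∣ i ∣ * fromℕ ℤ.∣ j ∣) ≈⟨ signed-* s t _ _ ⟩
    signed s (fromℕ ℤ.∣ i ∣) * signed t (fromℕ ℤ.∣ j ∣) ≈⟨ *-cong (fromℤ-sign i) (fromℤ-sign j) ⟨
    fromℤ i * fromℤ j                                 ∎
    where s = ℤ.sign i; t = ℤ.sign j

  fromℤ-neg : ∀ i → fromℤ (ℤ.- i) ≈ - fromℤ i
  fromℤ-neg (+ zero)  = sym -0#≈0#
  fromℤ-neg (+ suc n) = refl
  fromℤ-neg -[1+ n ]  = sym (-‿involutive _)

  private
    fromℤ-homomorphism : ℤ.+-*-rawRing -Raw-AlmostCommutative⟶ fromCommutativeRing R
    fromℤ-homomorphism = record
      { ⟦_⟧ = fromℤ ; +-homo = fromℤ-+ ; *-homo = fromℤ-* ; -‿homo = fromℤ-neg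
      ; 0-homo = refl ; 1-homo = refl }

    ≡⇒fromℤ-≈ : ∀ i j → Maybe (fromℤ i ≈ fromℤ j)
    ≡⇒fromℤ-≈ i j with i ℤ.≟ j
    ... | yes ≡.refl = just refl
    ... | no _       = nothing

  open import Algebra.Solver.Ring ℤ.+-*-rawRing (fromCommutativeRing R) fromℤ-homomorphism ≡⇒fromℤ-≈
    public

m∣n∧m∣o∧o<n+m⇒o≤n : ∀ {m n o} → m ∣ n → m ∣ o → o ℕ.< n ℕ.+ m → o ℕ.≤ n
m∣n∧m∣o∧o<n+m⇒o≤n {zero}  (divides a ≡.refl) (divides c ≡.refl) _ =
  ℕP.≤-reflexive (≡.trans (ℕP.*-zeroʳ c) (≡.sym (ℕP.*-zeroʳ a)))
m∣n∧m∣o∧o<n+m⇒o≤n {suc m} (divides a ≡.refl) (divides c ≡.refl) o<n+m =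
  ℕP.*-monoˡ-≤ (suc m) (ℕP.≤-pred (ℕP.*-cancelʳ-< (suc m) c (suc a)
    (≡.subst (c ℕ.* suc m ℕ.<_) (ℕP.+-comm (a ℕ.* suc m) (suc m)) o<n+m)))

even-or-odd : ∀ n → ∃ λ t → n ≡ t ℕ.+ t ⊎ n ≡ suc (t ℕ.+ t)
even-or-odd zero = 0 , inj₁ ≡.refl
even-or-odd (suc n) with even-or-odd n
... | t , inj₁ n≡t+t   = t , inj₂ (≡.cong suc n≡t+t)
... | t , inj₂ n≡1+t+t = suc t , inj₁ (≡.cong suc (≡.trans n≡1+t+t (≡.sym (ℕP.+-suc t t))))

module Cardinality where

  open ≡ using (refl; cong; cong₂; sym; trans; subst)
  open import Data.Nat using (_+_; _*_; _≤_; _<_; z≤n; s≤s)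
  open import Data.Fin using (zero; suc)
  open FinP using (_≟_)

  open CommutativeMonoidSum ℕP.+-0-commutativeMonoid using (sum; sum-cong-≗; ∑-distrib-+; ∑-comm; ∑-permute)

  Subset : ℕ → Set
  Subset n = Fin n → Bool

  infix 4 _∈_ _⊆_ _≡ᵇ_

  _∈_ : ∀ {n} → Fin n → Subset n → Set
  i ∈ X = X i ≡ true

  _⊆_ : ∀ {n} → Subset n → Subset n → Set
  X ⊆ Y = ∀ i → i ∈ X → i ∈ Y

  _≡ᵇ_ : ∀ {n} → Fin n → Fin n → Bool
  i ≡ᵇ j = does (i ≟ j)

  ≡ᵇ-refl : ∀ {n} (i : Fin n) → (i ≡ᵇ i) ≡ true
  ≡ᵇ-refl i = dec-true (i ≟ i) refl

  ≡ᵇ⇒≡ : ∀ {n} {i j : Fin n} → (i ≡ᵇ j) ≡ true → i ≡ j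
  ≡ᵇ⇒≡ {i = i} {j} e with i ≟ j | e
  ... | yes i≡j | _ = i≡j

  ≡⇒≡ᵇ : ∀ {n} {i j : Fin n} → i ≡ j → (i ≡ᵇ j) ≡ true
  ≡⇒≡ᵇ {i = i} refl = ≡ᵇ-refl i

  ≢⇒≡ᵇ-false : ∀ {n} {i j : Fin n} → i ≢ j → (i ≡ᵇ j) ≡ false
  ≢⇒≡ᵇ-false {i = i} {j} = dec-false (i ≟ j)

  ≡ᵇ-sym : ∀ {n} (i j : Fin n) → (i ≡ᵇ j) ≡ (j ≡ᵇ i)
  ≡ᵇ-sym i j with i ≟ j
  ... | yes refl = sym (≡ᵇ-refl i)
  ... | no  i≢j  = sym (≢⇒≡ᵇ-false (i≢j ∘ sym))

  false⇒∉ : ∀ {n} {X : Subset n} {i} → X i ≡ false → ¬ (i ∈ X)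
  false⇒∉ i∉X i∈X with () ← trans (sym i∉X) i∈X

  ≡true-ext : ∀ {a b : Bool} → (a ≡ true → b ≡ true) → (b ≡ true → a ≡ true) → a ≡ b
  ≡true-ext {false} {false} _ _ = refl
  ≡true-ext {false} {true}  _ g = g refl
  ≡true-ext {true}  {b}     f _ = sym (f refl)

  ∧-elimˡ : ∀ {a b} → (a ∧ b) ≡ true → a ≡ true
  ∧-elimˡ {true} _ = refl

  ∧-elimʳ : ∀ {a b} → (a ∧ b) ≡ true → b ≡ true
  ∧-elimʳ {true} e = e

  ∧-intro : ∀ {a b} → a ≡ true → b ≡ true → (a ∧ b) ≡ true
  ∧-intro refl refl = refl

  anyᵇ : ∀ {n} → Subset n → Bool
  anyᵇ {zero}  X = false
  anyᵇ {suc n} X = X zero ∨ anyᵇ (X ∘ suc)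

  anyᵇ-intro : ∀ {n} (X : Subset n) i → i ∈ X → anyᵇ X ≡ true
  anyᵇ-intro X zero    i∈X rewrite i∈X = refl
  anyᵇ-intro X (suc i) i∈X rewrite anyᵇ-intro (X ∘ suc) i i∈X = BoolP.∨-zeroʳ (X zero)

  anyᵇ-elim : ∀ {n} (X : Subset n) → anyᵇ X ≡ true → ∃ (_∈ X)
  anyᵇ-elim {suc n} X e with X zero in X0
  ... | true  = zero , X0
  ... | false with anyᵇ-elim (X ∘ suc) e
  ...   | i , i∈X = suc i , i∈X

  anyᵇ-cong : ∀ {n} {X Y : Subset n} → (∀ i → X i ≡ Y i) → anyᵇ X ≡ anyᵇ Y
  anyᵇ-cong {zero}  X≗Y = refl
  anyᵇ-cong {suc n} X≗Y = cong₂ _∨_ (X≗Y zero) (anyᵇ-cong (X≗Y ∘ suc))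

  ⁅_⁆ : ∀ {n} → Fin n → Subset n
  ⁅ a ⁆ i = i ≡ᵇ a

  _∖_ : ∀ {n} → Subset n → Subset n → Subset n
  (X ∖ Y) i = X i ∧ not (Y i)

  _∩_ : ∀ {n} → Subset n → Subset n → Subset n
  (X ∩ Y) i = X i ∧ Y i

  _∪_ : ∀ {n} → Subset n → Subset n → Subset n
  (X ∪ Y) i = X i ∨ Y i

  ∈∖⇒∉ : ∀ {n} {X Y : Subset n} {i} → i ∈ X ∖ Y → Y i ≡ false
  ∈∖⇒∉ {X = X} {Y} {i} i∈X∖Y with X i | Y i
  ... | true | false = refl

  boolToℕ : Bool → ℕ
  boolToℕ true  = 1
  boolToℕ false = 0

  ∣_∣ : ∀ {n} → Subset n → ℕ
  ∣ X ∣ = sum (boolToℕ ∘ X)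

  private
    sum-mono : ∀ {n} {f g : Fin n → ℕ} → (∀ i → f i ≤ g i) → sum f ≤ sum g
    sum-mono {zero}  f≤g = z≤n
    sum-mono {suc n} f≤g = ℕP.+-mono-≤ (f≤g zero) (sum-mono (f≤g ∘ suc))

    sum-*ˡ : ∀ {n} s (f : Fin n → ℕ) → sum (λ i → s * f i) ≡ s * sum f
    sum-*ˡ s f = sym (*-distribˡ-sum s f)
      where open import Algebra.Properties.Semiring.Sum ℕP.+-*-semiring using (*-distribˡ-sum)

    sum-pos : ∀ {n} (f : Fin n → ℕ) → 1 ≤ sum f → ∃ λ i → 1 ≤ f i
    sum-pos {suc n} f 1≤Σ with f zero in f0
    ... | suc _ = zero , subst (1 ≤_) (sym f0) (s≤s z≤n)
    ... | zero with sum-pos (f ∘ suc) 1≤Σ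
    ...   | i , 1≤fi = suc i , 1≤fi

    sum-point : ∀ {n} (f : Fin n → ℕ) i → f i ≤ sum f
    sum-point f zero    = ℕP.m≤m+n _ _
    sum-point f (suc i) = ℕP.≤-trans (sum-point (f ∘ suc) i) (ℕP.m≤n+m _ _)

  ∣∣-cong : ∀ {n} {X Y : Subset n} → (∀ i → X i ≡ Y i) → ∣ X ∣ ≡ ∣ Y ∣
  ∣∣-cong {n} X≗Y = sum-cong-≗ {n} (cong boolToℕ ∘ X≗Y)

  ∣⊤∣≡n : ∀ {n} → ∣ (λ (_ : Fin n) → true) ∣ ≡ n
  ∣⊤∣≡n {zero}  = refl
  ∣⊤∣≡n {suc n} = cong suc (∣⊤∣≡n {n})

  ∅⇒∣X∣≡0 : ∀ {n} (X : Subset n) → (∀ i → X i ≡ false) → ∣ X ∣ ≡ 0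
  ∅⇒∣X∣≡0 {zero}  X X≗∅ = refl
  ∅⇒∣X∣≡0 {suc n} X X≗∅ rewrite X≗∅ zero = ∅⇒∣X∣≡0 (X ∘ suc) (X≗∅ ∘ suc)

  ∈⇒1≤∣X∣ : ∀ {n} (X : Subset n) {i} → i ∈ X → 1 ≤ ∣ X ∣
  ∈⇒1≤∣X∣ X {i} i∈X = ℕP.≤-trans (ℕP.≤-reflexive (cong boolToℕ (sym i∈X))) (sum-point (boolToℕ ∘ X) i)

  1≤∣X∣⇒∈ : ∀ {n} (X : Subset n) → 1 ≤ ∣ X ∣ → ∃ (_∈ X)
  1≤∣X∣⇒∈ X 1≤∣X∣ with sum-pos (boolToℕ ∘ X) 1≤∣X∣
  ... | i , 1≤Xi with X i in Xi
  ...   | true = i , Xi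

  ⊆⇒∣∣-≤ : ∀ {n} {X Y : Subset n} → X ⊆ Y → ∣ X ∣ ≤ ∣ Y ∣
  ⊆⇒∣∣-≤ {n} {X} {Y} X⊆Y = sum-mono {n} (λ i → bit-mono (X⊆Y i))
    where
    bit-mono : ∀ {a b} → (a ≡ true → b ≡ true) → boolToℕ a ≤ boolToℕ b
    bit-mono {false}         _ = z≤n
    bit-mono {true}  {true}  _ = ℕP.≤-refl
    bit-mono {true}  {false} f with () ← f refl

  ⊆⇒∣Y∣≡∣X∣+∣Y∖X∣ : ∀ {n} {X Y : Subset n} → X ⊆ Y → ∣ Y ∣ ≡ ∣ X ∣ + ∣ Y ∖ X ∣
  ⊆⇒∣Y∣≡∣X∣+∣Y∖X∣ {n} {X} {Y} X⊆Y = trans (sum-cong-≗ {n} (λ i → split (X⊆Y i))) (∑-distrib-+ {n} _ _)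
    where
    split : ∀ {a b} → (a ≡ true → b ≡ true) → boolToℕ b ≡ boolToℕ a + boolToℕ (b ∧ not a)
    split {false} {false} _ = refl
    split {false} {true}  _ = refl
    split {true}  {true}  _ = refl
    split {true}  {false} f with () ← f refl

  ∣⁅a⁆∣≡1 : ∀ {n} (a : Fin n) → ∣ ⁅ a ⁆ ∣ ≡ 1
  ∣⁅a⁆∣≡1 {suc n} zero    = cong suc (∅⇒∣X∣≡0 {n} _ (λ _ → refl))
  ∣⁅a⁆∣≡1 {suc n} (suc a) = ∣⁅a⁆∣≡1 a

  ∣X∣≡∣X∖⁅a⁆∣+[a∈X] : ∀ {n} (X : Subset n) a → ∣ X ∣ ≡ ∣ X ∖ ⁅ a ⁆ ∣ + boolToℕ (X a)
  ∣X∣≡∣X∖⁅a⁆∣+[a∈X] {n} X a =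
    trans (sum-cong-≗ {n} split) (trans (∑-distrib-+ {n} _ _) (cong (∣ X ∖ ⁅ a ⁆ ∣ +_) at-a))
    where
    split : ∀ i → boolToℕ (X i) ≡ boolToℕ ((X ∖ ⁅ a ⁆) i) + boolToℕ (X i ∧ (i ≡ᵇ a))
    split i with X i | i ≡ᵇ a
    ... | false | _     = refl
    ... | true  | false = refl
    ... | true  | true  = refl
    at-a : ∣ (λ i → X i ∧ (i ≡ᵇ a)) ∣ ≡ boolToℕ (X a)
    at-a with X a in Xa
    ... | true  = trans (∣∣-cong pt) (∣⁅a⁆∣≡1 a)
      where
      pt : ∀ i → (X i ∧ (i ≡ᵇ a)) ≡ (i ≡ᵇ a)
      pt i with i ≟ a
      ... | yes refl = trans (BoolP.∧-identityʳ _) Xa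
      ... | no  _    = BoolP.∧-zeroʳ (X i)
    ... | false = ∅⇒∣X∣≡0 _ pt
      where
      pt : ∀ i → (X i ∧ (i ≡ᵇ a)) ≡ false
      pt i with i ≟ a
      ... | yes refl = trans (BoolP.∧-identityʳ _) Xa
      ... | no  _    = BoolP.∧-zeroʳ (X i)

  ∣X∪Y∣≤∣X∣+∣Y∣ : ∀ {n} (X Y : Subset n) → ∣ X ∪ Y ∣ ≤ ∣ X ∣ + ∣ Y ∣
  ∣X∪Y∣≤∣X∣+∣Y∣ {n} X Y = subst (∣ X ∪ Y ∣ ≤_) (∑-distrib-+ {n} _ _) (sum-mono {n} (λ i → bit-∨ (X i) (Y i)))
    where
    bit-∨ : ∀ a b → boolToℕ (a ∨ b) ≤ boolToℕ a + boolToℕ b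
    bit-∨ false b     = ℕP.≤-refl
    bit-∨ true  false = ℕP.≤-refl
    bit-∨ true  true  = s≤s z≤n

  ⊆∧∣Y∣≤∣X∣⇒Y⊆X : ∀ {n} {X Y : Subset n} → X ⊆ Y → ∣ Y ∣ ≤ ∣ X ∣ → Y ⊆ X
  ⊆∧∣Y∣≤∣X∣⇒Y⊆X {X = X} {Y} X⊆Y ∣Y∣≤∣X∣ i i∈Y with X i in Xi
  ... | true  = refl
  ... | false = ⊥-elim (ℕP.<⇒≱ ∣X∣<∣Y∣ ∣Y∣≤∣X∣)
    where
    i∈Y∖X : i ∈ Y ∖ X
    i∈Y∖X = ∧-intro i∈Y (cong not Xi)
    ∣X∣<∣Y∣ : ∣ X ∣ < ∣ Y ∣
    ∣X∣<∣Y∣ = subst (∣ X ∣ <_) (sym (⊆⇒∣Y∣≡∣X∣+∣Y∖X∣ X⊆Y))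
                (subst (_≤ ∣ X ∣ + ∣ Y ∖ X ∣) (ℕP.+-comm ∣ X ∣ 1)
                  (ℕP.+-monoʳ-≤ ∣ X ∣ (∈⇒1≤∣X∣ (Y ∖ X) i∈Y∖X)))

  ∣X∣≤1⇒∈-unique : ∀ {n} {X : Subset n} {a b} → ∣ X ∣ ≤ 1 → a ∈ X → b ∈ X → a ≡ b
  ∣X∣≤1⇒∈-unique {X = X} {a} {b} ∣X∣≤1 a∈X b∈X with a ≟ b
  ... | yes a≡b = a≡b
  ... | no  a≢b = ⊥-elim (ℕP.<⇒≱ 1<∣X∣ ∣X∣≤1)
    where
    ⁅a⁆⊆X : ⁅ a ⁆ ⊆ X
    ⁅a⁆⊆X i i∈⁅a⁆ = subst (_∈ X) (sym (≡ᵇ⇒≡ i∈⁅a⁆)) a∈X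
    b∈X∖⁅a⁆ : b ∈ X ∖ ⁅ a ⁆
    b∈X∖⁅a⁆ = ∧-intro b∈X (cong not (≢⇒≡ᵇ-false (a≢b ∘ sym)))
    1<∣X∣ : 1 < ∣ X ∣
    1<∣X∣ = subst (1 <_) (sym (trans (⊆⇒∣Y∣≡∣X∣+∣Y∖X∣ ⁅a⁆⊆X) (cong (_+ ∣ X ∖ ⁅ a ⁆ ∣) (∣⁅a⁆∣≡1 a))))
                  (s≤s (∈⇒1≤∣X∣ (X ∖ ⁅ a ⁆) b∈X∖⁅a⁆))

  ∣X∘f∣≡∣X∣ : ∀ {n} (X : Subset n) (f g : Fin n → Fin n) →
              (∀ i → f (g i) ≡ i) → (∀ i → g (f i) ≡ i) → ∣ X ∘ f ∣ ≡ ∣ X ∣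
  ∣X∘f∣≡∣X∣ X f g f∘g g∘f = sym (∑-permute (boolToℕ ∘ X) (permutation f g f∘g g∘f))

  module _ {n m} (f : Fin n → Fin m) where

    ∣X∣≡∑∣fibre∣ : ∀ X → ∣ X ∣ ≡ sum (λ y → ∣ X ∩ (⁅ y ⁆ ∘ f) ∣)
    ∣X∣≡∑∣fibre∣ X = trans (sum-cong-≗ {n} one-fibre) (∑-comm (λ x y → boolToℕ (X x ∧ (f x ≡ᵇ y))))
      where
      bit-∧ : ∀ a b → boolToℕ (a ∧ b) ≡ boolToℕ a * boolToℕ b
      bit-∧ false b     = refl
      bit-∧ true  false = refl
      bit-∧ true  true  = refl
      one-fibre : ∀ x → boolToℕ (X x) ≡ sum (λ y → boolToℕ (X x ∧ (f x ≡ᵇ y)))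
      one-fibre x = begin
        boolToℕ (X x)                                   ≡⟨ ℕP.*-identityʳ _ ⟨
        boolToℕ (X x) * 1                               ≡⟨ cong (boolToℕ (X x) *_) (∣⁅a⁆∣≡1 (f x)) ⟨
        boolToℕ (X x) * ∣ ⁅ f x ⁆ ∣
          ≡⟨ cong (boolToℕ (X x) *_) (∣∣-cong {m} (λ y → ≡ᵇ-sym y (f x))) ⟩
        boolToℕ (X x) * sum (λ y → boolToℕ (f x ≡ᵇ y))  ≡⟨ sum-*ˡ {m} (boolToℕ (X x)) _ ⟨
        sum (λ y → boolToℕ (X x) * boolToℕ (f x ≡ᵇ y))  ≡⟨ sum-cong-≗ {m} (λ y → bit-∧ (X x) _) ⟨
        sum (λ y → boolToℕ (X x ∧ (f x ≡ᵇ y)))          ∎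
        where open ≡.≡-Reasoning

    ∣fibre∣≤s⇒∣X∣≤s*∣Y∣ : ∀ {X Y} s → (∀ x → x ∈ X → f x ∈ Y) →
                          (∀ y → ∣ X ∩ (⁅ y ⁆ ∘ f) ∣ ≤ s) → ∣ X ∣ ≤ s * ∣ Y ∣
    ∣fibre∣≤s⇒∣X∣≤s*∣Y∣ {X} {Y} s f[X]⊆Y ∣fibre∣≤s = begin
      ∣ X ∣                                       ≡⟨ ∣X∣≡∑∣fibre∣ X ⟩
      sum (λ y → ∣ X ∩ (⁅ y ⁆ ∘ f) ∣)              ≤⟨ sum-mono {m} fibre-bound ⟩
      sum (λ y → s * boolToℕ (Y y))               ≡⟨ sum-*ˡ s (boolToℕ ∘ Y) ⟩
      s * ∣ Y ∣                                   ∎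
      where
      open ℕP.≤-Reasoning
      fibre-bound : ∀ y → ∣ X ∩ (⁅ y ⁆ ∘ f) ∣ ≤ s * boolToℕ (Y y)
      fibre-bound y with Y y in Yy
      ... | true  = subst (∣ X ∩ (⁅ y ⁆ ∘ f) ∣ ≤_) (sym (ℕP.*-identityʳ s)) (∣fibre∣≤s y)
      ... | false = ℕP.≤-reflexive (trans (∅⇒∣X∣≡0 _ empty) (sym (ℕP.*-zeroʳ s)))
        where
        empty : ∀ x → (X x ∧ (f x ≡ᵇ y)) ≡ false
        empty x with X x in Xx | f x ≟ y
        ... | false | _         = refl
        ... | true  | no  _     = refl
        ... | true  | yes refl  with () ← trans (sym Yy) (f[X]⊆Y x Xx)

  module _ {n} (R : Fin n → Subset n)
           (R-refl : ∀ x → x ∈ R x)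
           (R-sym : ∀ {x y} → y ∈ R x → x ∈ R y)
           (R-trans : ∀ {x y z} → y ∈ R x → z ∈ R y → z ∈ R x) where

    Saturated : Subset n → Set
    Saturated X = ∀ {x y} → x ∈ X → y ∈ R x → y ∈ X

    classSize∣∣X∣ : ∀ {X} s → Saturated X → (∀ {x} → x ∈ X → ∣ R x ∣ ≡ s) → s ∣ ∣ X ∣
    classSize∣∣X∣ {X} s = go (suc ∣ X ∣) X ℕP.≤-refl
      where
      go : ∀ t X → ∣ X ∣ < t → Saturated X → (∀ {x} → x ∈ X → ∣ R x ∣ ≡ s) → s ∣ ∣ X ∣
      go (suc t) X ∣X∣<1+t sat size with 1 ℕ.≤? ∣ X ∣
      ... | no  ∣X∣≱1 = subst (s ∣_) (sym (ℕP.n<1⇒n≡0 (ℕP.≰⇒> ∣X∣≱1))) (s ∣0)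
      ... | yes ∣X∣≥1 with 1≤∣X∣⇒∈ X ∣X∣≥1
      ...   | x , x∈X = subst (s ∣_) (sym ∣X∣≡s+∣X′∣) (∣m∣n⇒∣m+n ∣-refl (go t X′ ∣X′∣<t sat′ size′))
        where
        X′ : Subset n
        X′ = X ∖ R x
        Rx⊆X : R x ⊆ X
        Rx⊆X y = sat x∈X
        ∣X∣≡s+∣X′∣ : ∣ X ∣ ≡ s + ∣ X′ ∣
        ∣X∣≡s+∣X′∣ = trans (⊆⇒∣Y∣≡∣X∣+∣Y∖X∣ Rx⊆X) (cong (_+ ∣ X′ ∣) (size x∈X))
        ∣X′∣<t : ∣ X′ ∣ < t
        ∣X′∣<t = ℕP.<-≤-trans (ℕP.+-monoˡ-≤ ∣ X′ ∣ (∈⇒1≤∣X∣ (R x) (R-refl x)))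
                   (ℕP.≤-trans (ℕP.≤-reflexive (sym (⊆⇒∣Y∣≡∣X∣+∣Y∖X∣ Rx⊆X))) (ℕP.≤-pred ∣X∣<1+t))
        sat′ : Saturated X′
        sat′ {y} {z} y∈X′ z∈Ry = ∧-intro (sat (∧-elimˡ y∈X′) z∈Ry) z∉Rx
          where
          z∉Rx : not (R x z) ≡ true
          z∉Rx with R x z in z∈Rx
          ... | false = refl
          ... | true  with () ← trans (sym (∧-elimʳ {X y} y∈X′)) (cong not (R-trans z∈Rx (R-sym z∈Ry)))
        size′ : ∀ {y} → y ∈ X′ → ∣ R y ∣ ≡ s
        size′ = size ∘ ∧-elimˡ

  ∣Y∖X∣≤1⇒Y≡X∪⁅e⁆ : ∀ {n} {X Y : Subset n} {e} → X ⊆ Y → ∣ Y ∖ X ∣ ≤ 1 → e ∈ Y ∖ X →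
                    ∀ i → Y i ≡ (X ∪ ⁅ e ⁆) i
  ∣Y∖X∣≤1⇒Y≡X∪⁅e⁆ {X = X} {Y} {e} X⊆Y ∣Y∖X∣≤1 e∈Y∖X i = ≡true-ext to from
    where
    to : i ∈ Y → i ∈ X ∪ ⁅ e ⁆
    to i∈Y with X i in Xi
    ... | true  = refl
    ... | false = ≡⇒≡ᵇ (∣X∣≤1⇒∈-unique {X = Y ∖ X} ∣Y∖X∣≤1 (∧-intro i∈Y (cong not Xi)) e∈Y∖X)
    from : i ∈ X ∪ ⁅ e ⁆ → i ∈ Y
    from i∈ with X i in Xi
    ... | true  = X⊆Y i Xi
    ... | false = subst (_∈ Y) (sym (≡ᵇ⇒≡ i∈)) (∧-elimˡ e∈Y∖X)

-- Every finite field is isomorphic to one on Fin N, where equality is decidable and the elements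
-- can be enumerated.
record FinField (N : ℕ) : Set where
  infixl 6 _+_
  infixl 7 _*_
  field
    _+_ _*_           : Fin N → Fin N → Fin N
    -_                : Fin N → Fin N
    0# 1#             : Fin N
    isCommutativeRing : IsCommutativeRing _≡_ _+_ _*_ -_ 0# 1#
    1≢0               : 1# ≢ 0#
    inverse           : ∀ x → x ≢ 0# → ∃ λ y → x * y ≡ 1#

  commutativeRing : CommutativeRing 0ℓ 0ℓ
  commutativeRing = record { isCommutativeRing = isCommutativeRing }

module FinFieldTheory {N : ℕ} (F : FinField N) where

  open ≡ using (refl; cong; cong₂; sym; trans; subst)
  open FinField F public using (1≢0; inverse; commutativeRing)
  open CommutativeRing commutativeRing public
    using ( _+_; _*_; -_; _-_; 0#; 1#; +-assoc; +-comm; +-identityˡ; +-identityʳ; -‿inverseʳ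
          ; *-assoc; *-comm; *-identityˡ; *-identityʳ; zeroˡ; zeroʳ
          ; +-monoid; +-commutativeMonoid; semiring; commutativeSemiring; ring)
  open IntegerCoefficientRingSolver commutativeRing public
    using (solve; _:=_; _:+_; _:*_; :-_; _:-_; con; Polynomial; fromℕ; fromℕ-+; fromℕ-*)
  open import Algebra.Definitions.RawSemiring (Semiring.rawSemiring semiring) public using (_^_; sum)
  open import Algebra.Properties.Semiring.Exp semiring public using (^-homo-*)
  open import Algebra.Properties.CommutativeSemiring.Exp commutativeSemiring public using (^-distrib-*)
  open import Algebra.Properties.Ring ring public using (-0#≈0#)
  open Cardinality
  open ≡.≡-Reasoning

  K : Set
  K = Fin N

  :0 :1 : ∀ {n} → Polynomial n
  :0 = con (ℤ.+ 0)
  :1 = con (ℤ.+ 1)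

  x*y≡0⇒x≡0⊎y≡0 : ∀ {x y} → x * y ≡ 0# → x ≡ 0# ⊎ y ≡ 0#
  x*y≡0⇒x≡0⊎y≡0 {x} {y} xy≡0 with x FinP.≟ 0#
  ... | yes x≡0 = inj₁ x≡0
  ... | no  x≢0 with inverse x x≢0
  ...   | x′ , xx′≡1 = inj₂ (begin
    y               ≡⟨ *-identityˡ y ⟨
    1# * y          ≡⟨ cong (_* y) xx′≡1 ⟨
    (x * x′) * y    ≡⟨ solve 3 (λ x x′ y → (x :* x′) :* y := x′ :* (x :* y)) refl x x′ y ⟩
    x′ * (x * y)    ≡⟨ cong (x′ *_) xy≡0 ⟩
    x′ * 0#         ≡⟨ zeroʳ x′ ⟩
    0#              ∎)

  x≢0∧y≢0⇒x*y≢0 : ∀ {x y} → x ≢ 0# → y ≢ 0# → x * y ≢ 0#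
  x≢0∧y≢0⇒x*y≢0 x≢0 y≢0 xy≡0 with x*y≡0⇒x≡0⊎y≡0 xy≡0
  ... | inj₁ x≡0 = x≢0 x≡0
  ... | inj₂ y≡0 = y≢0 y≡0

  x-y≡0⇒x≡y : ∀ {x y} → x - y ≡ 0# → x ≡ y
  x-y≡0⇒x≡y {x} {y} x-y≡0 = begin
    x             ≡⟨ solve 2 (λ x y → x := (x :- y) :+ y) refl x y ⟩
    (x - y) + y   ≡⟨ cong (_+ y) x-y≡0 ⟩
    0# + y        ≡⟨ +-identityˡ y ⟩
    y             ∎

  *-cancelˡ : ∀ {a x y} → a ≢ 0# → a * x ≡ a * y → x ≡ y
  *-cancelˡ {a} {x} {y} a≢0 ax≡ay = [ ⊥-elim ∘ a≢0 , x-y≡0⇒x≡y ]′ (x*y≡0⇒x≡0⊎y≡0 a[x-y]≡0)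
    where
    a[x-y]≡0 : a * (x - y) ≡ 0#
    a[x-y]≡0 = begin
      a * (x - y)       ≡⟨ solve 3 (λ a x y → a :* (x :- y) := a :* x :- a :* y) refl a x y ⟩
      a * x - a * y     ≡⟨ cong (_- a * y) ax≡ay ⟩
      a * y - a * y     ≡⟨ -‿inverseʳ (a * y) ⟩
      0#                ∎

  x-c+c≡x : ∀ c x → x - c + c ≡ x
  x-c+c≡x c x = solve 2 (λ c x → x :- c :+ c := x) refl c x

  x+c-c≡x : ∀ c x → x + c - c ≡ x
  x+c-c≡x c x = solve 2 (λ c x → x :+ c :- c := x) refl c x

  x*y≡1⇒y*[x*z]≡z : ∀ {x y} → x * y ≡ 1# → ∀ z → y * (x * z) ≡ z
  x*y≡1⇒y*[x*z]≡z {x} {y} xy≡1 z = begin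
    y * (x * z)   ≡⟨ solve 3 (λ x y z → y :* (x :* z) := (x :* y) :* z) refl x y z ⟩
    (x * y) * z   ≡⟨ cong (_* z) xy≡1 ⟩
    1# * z        ≡⟨ *-identityˡ z ⟩
    z             ∎

  x*y≡1⇒x*[y*z]≡z : ∀ {x y} → x * y ≡ 1# → ∀ z → x * (y * z) ≡ z
  x*y≡1⇒x*[y*z]≡z {x} {y} xy≡1 = x*y≡1⇒y*[x*z]≡z (trans (*-comm y x) xy≡1)

  x*y≡1⇒y≢0 : ∀ {x y} → x * y ≡ 1# → y ≢ 0#
  x*y≡1⇒y≢0 {x} xy≡1 y≡0 = 1≢0 (trans (sym xy≡1) (trans (cong (x *_) y≡0) (zeroʳ x)))

  x+1≡0∧x≢1⇒1+1≢0 : ∀ {x} → x + 1# ≡ 0# → x ≢ 1# → 1# + 1# ≢ 0#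
  x+1≡0∧x≢1⇒1+1≢0 {x} x+1≡0 x≢1 1+1≡0 = x≢1 (begin
    x                   ≡⟨ solve 1 (λ x → x := x :+ :1 :- :1) refl x ⟩
    x + 1# - 1#         ≡⟨ cong (_- 1#) (trans x+1≡0 (sym 1+1≡0)) ⟩
    1# + 1# - 1#        ≡⟨ solve 0 (:1 :+ :1 :- :1 := :1) refl ⟩
    1#                  ∎)

  ^-≢0 : ∀ {x} n → x ≢ 0# → x ^ n ≢ 0#
  ^-≢0 zero    x≢0 = 1≢0
  ^-≢0 (suc n) x≢0 = x≢0∧y≢0⇒x*y≢0 x≢0 (^-≢0 n x≢0)

  1^n≡1 : ∀ n → 1# ^ n ≡ 1#
  1^n≡1 zero    = refl
  1^n≡1 (suc n) = trans (*-identityˡ _) (1^n≡1 n)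

  finite-order : ∀ {c} → c ≢ 0# → ∃ λ t → c ^ suc t ≡ 1#
  finite-order {c} c≢0 with FinP.pigeonhole (ℕP.n<1+n N) (λ (i : Fin (suc N)) → c ^ toℕ i)
  ... | i , j , i<j , cⁱ≡cʲ = t , sym (*-cancelˡ (^-≢0 (toℕ i) c≢0) (begin
    c ^ toℕ i * 1#                 ≡⟨ *-identityʳ _ ⟩
    c ^ toℕ i                      ≡⟨ cⁱ≡cʲ ⟩
    c ^ toℕ j                      ≡⟨ cong (c ^_) j≡i+1+t ⟩
    c ^ (toℕ i ℕ.+ suc t)          ≡⟨ ^-homo-* c (toℕ i) (suc t) ⟩
    c ^ toℕ i * c ^ suc t          ∎))
    where
    t : ℕ
    t = toℕ j ℕ.∸ suc (toℕ i)
    j≡i+1+t : toℕ j ≡ toℕ i ℕ.+ suc t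
    j≡i+1+t = trans (sym (ℕP.m+[n∸m]≡n i<j)) (sym (ℕP.+-suc (toℕ i) t))

  nonzero : Subset N
  nonzero x = not (x ≡ᵇ 0#)

  ∈nonzero⇒≢0 : ∀ {x} → x ∈ nonzero → x ≢ 0#
  ∈nonzero⇒≢0 {x} x∈ refl with () ← trans (sym x∈) (cong not (≡ᵇ-refl x))

  ≢0⇒∈nonzero : ∀ {x} → x ≢ 0# → x ∈ nonzero
  ≢0⇒∈nonzero x≢0 = cong not (≢⇒≡ᵇ-false x≢0)

  1+∣nonzero∣≡N : suc ∣ nonzero ∣ ≡ N
  1+∣nonzero∣≡N = trans (ℕP.+-comm 1 ∣ nonzero ∣) (sym (trans (sym ∣⊤∣≡n) (∣X∣≡∣X∖⁅a⁆∣+[a∈X] _ 0#)))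

  -- Polynomial functions and their roots

  data Degree≤ : ℕ → (K → K) → Set where
    constant : ∀ {f} c → (∀ x → f x ≡ c) → Degree≤ zero f
    horner   : ∀ {n f} c g → Degree≤ n g → (∀ x → f x ≡ c + x * g x) → Degree≤ (suc n) f

  Degree≤-cong : ∀ {n f g} → Degree≤ n f → (∀ x → f x ≡ g x) → Degree≤ n g
  Degree≤-cong (constant c f≗c)   f≗g = constant c (λ x → trans (sym (f≗g x)) (f≗c x))
  Degree≤-cong (horner c h deg f≗) f≗g = horner c h deg (λ x → trans (sym (f≗g x)) (f≗ x))

  Degree≤-suc : ∀ {n f} → Degree≤ n f → Degree≤ (suc n) f
  Degree≤-suc (constant c f≗c) =
    horner c (λ _ → 0#) (constant 0# (λ _ → refl))
      (λ x → trans (f≗c x) (solve 2 (λ c x → c := c :+ x :* :0) refl c x))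
  Degree≤-suc (horner c g deg f≗) = horner c g (Degree≤-suc deg) f≗

  Degree≤-+* : ∀ {n a b} r → Degree≤ n a → Degree≤ n b → Degree≤ n (λ x → a x + r * b x)
  Degree≤-+* r (constant c a≗c) (constant c′ b≗c′) =
    constant (c + r * c′) (λ x → cong₂ _+_ (a≗c x) (cong (r *_) (b≗c′ x)))
  Degree≤-+* r (horner c g deg-g a≗) (horner c′ g′ deg-g′ b≗) =
    horner (c + r * c′) (λ x → g x + r * g′ x) (Degree≤-+* r deg-g deg-g′) λ x →
      trans (cong₂ _+_ (a≗ x) (cong (r *_) (b≗ x)))
        (solve 6 (λ c x g r c′ g′ → c :+ x :* g :+ r :* (c′ :+ x :* g′) := c :+ r :* c′ :+ x :* (g :+ r :* g′))
               refl c x (g x) r c′ (g′ x))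

  factor-theorem : ∀ {n f} → Degree≤ (suc n) f → ∀ r →
                   ∃ λ h → Degree≤ n h × (∀ x → f x - f r ≡ (x - r) * h x)
  factor-theorem {zero} {f} (horner c g (constant c′ g≗c′) f≗) r = (λ _ → c′) , constant c′ (λ _ → refl) , λ x → begin
    f x - f r                         ≡⟨ cong₂ _-_ (f≗ x) (f≗ r) ⟩
    c + x * g x - (c + r * g r)       ≡⟨ cong₂ (λ u v → c + x * u - (c + r * v)) (g≗c′ x) (g≗c′ r) ⟩
    c + x * c′ - (c + r * c′)
      ≡⟨ solve 4 (λ c x r c′ → c :+ x :* c′ :- (c :+ r :* c′) := (x :- r) :* c′) refl c x r c′ ⟩
    (x - r) * c′                      ∎
  factor-theorem {suc n} {f} (horner c g deg-g f≗) r with factor-theorem deg-g r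
  ... | h , deg-h , g-g[r]≡ = (λ x → g x + r * h x) , Degree≤-+* r deg-g (Degree≤-suc deg-h) , λ x → begin
    f x - f r                                ≡⟨ cong₂ _-_ (f≗ x) (f≗ r) ⟩
    c + x * g x - (c + r * g r)
      ≡⟨ solve 5 (λ c x r gx gr → c :+ x :* gx :- (c :+ r :* gr) := (x :- r) :* gx :+ r :* (gx :- gr))
               refl c x r (g x) (g r) ⟩
    (x - r) * g x + r * (g x - g r)          ≡⟨ cong (λ u → (x - r) * g x + r * u) (g-g[r]≡ x) ⟩
    (x - r) * g x + r * ((x - r) * h x)
      ≡⟨ solve 4 (λ x r gx hx → (x :- r) :* gx :+ r :* ((x :- r) :* hx) := (x :- r) :* (gx :+ r :* hx))
               refl x r (g x) (h x) ⟩
    (x - r) * (g x + r * h x)                ∎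

  roots : (K → K) → Subset N
  roots f x = f x ≡ᵇ 0#

  ∣roots∣≤degree : ∀ {n f} → Degree≤ n f → ∀ z → f z ≢ 0# → ∣ roots f ∣ ℕ.≤ n
  ∣roots∣≤degree {f = f} (constant c f≗c) z fz≢0 = ℕP.≤-reflexive (∅⇒∣X∣≡0 (roots f) no-root)
    where
    no-root : ∀ x → roots f x ≡ false
    no-root x = ≢⇒≡ᵇ-false (λ fx≡0 → fz≢0 (trans (f≗c z) (trans (sym (f≗c x)) fx≡0)))
  ∣roots∣≤degree {suc n} {f} deg-f z fz≢0 with FinP.any? (λ x → f x FinP.≟ 0#)
  ... | no  no-root =
    ℕP.≤-trans (ℕP.≤-reflexive (∅⇒∣X∣≡0 (roots f) (λ x → ≢⇒≡ᵇ-false (no-root ∘ (x ,_))))) ℕ.z≤n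
  ... | yes (r , fr≡0) with factor-theorem deg-f r
  ...   | h , deg-h , f≡[x-r]h =
    ℕP.≤-trans (⊆⇒∣∣-≤ roots⊆) (ℕP.≤-trans (∣X∪Y∣≤∣X∣+∣Y∣ ⁅ r ⁆ (roots h))
      (subst (ℕ._≤ suc n) (cong (ℕ._+ ∣ roots h ∣) (sym (∣⁅a⁆∣≡1 r)))
        (ℕ.s≤s (∣roots∣≤degree deg-h z hz≢0))))
    where
    f≡ : ∀ x → f x ≡ (x - r) * h x
    f≡ x = trans (sym (trans (cong (λ u → f x - u) fr≡0) (trans (cong (f x +_) -0#≈0#) (+-identityʳ _)))) (f≡[x-r]h x)
    hz≢0 : h z ≢ 0#
    hz≢0 hz≡0 = fz≢0 (trans (f≡ z) (trans (cong ((z - r) *_) hz≡0) (zeroʳ _)))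
    roots⊆ : roots f ⊆ ⁅ r ⁆ ∪ roots h
    roots⊆ x fx≡0 with x*y≡0⇒x≡0⊎y≡0 (trans (sym (f≡ x)) (≡ᵇ⇒≡ fx≡0))
    ... | inj₁ x-r≡0 rewrite x-y≡0⇒x≡y x-r≡0 = cong (_∨ roots h r) (≡ᵇ-refl r)
    ... | inj₂ hx≡0 = trans (cong ((x ≡ᵇ r) ∨_) (≡⇒≡ᵇ hx≡0)) (BoolP.∨-zeroʳ _)

  Degree≤-x^n+c : ∀ n c → Degree≤ n (λ x → x ^ n + c)
  Degree≤-x^n+c zero    c = constant (1# + c) (λ _ → refl)
  Degree≤-x^n+c (suc n) c = horner c (_^ n) (Degree≤-cong (Degree≤-x^n+c n 0#) (λ x → +-identityʳ _)) (λ x → +-comm _ _)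

  ∣x^[1+e]≡c∣≤1+e : ∀ e {c} → c ≢ 0# → ∣ (λ x → x ^ suc e ≡ᵇ c) ∣ ℕ.≤ suc e
  ∣x^[1+e]≡c∣≤1+e e {c} c≢0 =
    ℕP.≤-trans (⊆⇒∣∣-≤ ⊆roots) (∣roots∣≤degree (Degree≤-x^n+c (suc e) (- c)) 0# 0^[1+e]-c≢0)
    where
    ⊆roots : (λ x → x ^ suc e ≡ᵇ c) ⊆ roots (λ x → x ^ suc e + - c)
    ⊆roots x x^[1+e]≡c = ≡⇒≡ᵇ (trans (cong (_- c) (≡ᵇ⇒≡ x^[1+e]≡c)) (-‿inverseʳ c))
    0^[1+e]-c≢0 : 0# ^ suc e + - c ≢ 0#
    0^[1+e]-c≢0 e≡0 = c≢0 (sym (x-y≡0⇒x≡y (trans (cong (_- c) (sym (zeroˡ _))) e≡0)))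

  module ∑K = CommutativeMonoidSum +-commutativeMonoid

  sum-∘-bijection : ∀ (f g : K → K) → (∀ x → f (g x) ≡ x) → (∀ x → g (f x) ≡ x) →
                    ∀ h → sum (h ∘ f) ≡ sum h
  sum-∘-bijection f g f∘g g∘f h = sym (∑K.∑-permute h (permutation f g f∘g g∘f))

  fromℕ-N≡0 : fromℕ N ≡ 0#
  fromℕ-N≡0 = begin
    fromℕ N                        ≡⟨ solve 2 (λ a s → a := (s :+ a) :- s) refl (fromℕ N) Σx ⟩
    (Σx + fromℕ N) - Σx            ≡⟨ cong (_- Σx) Σx+N≡Σx ⟩
    Σx - Σx                        ≡⟨ -‿inverseʳ Σx ⟩
    0#                             ∎
    where
    Σx : K
    Σx = sum {N} (λ x → x)
    Σx+N≡Σx : Σx + fromℕ N ≡ Σx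
    Σx+N≡Σx = begin
      Σx + fromℕ N                 ≡⟨ cong (Σx +_) (trans (∑K.sum-replicate N) (×ᵤ≈× +-monoid N 1#)) ⟨
      Σx + sum {N} (λ _ → 1#)      ≡⟨ ∑K.∑-distrib-+ {N} (λ x → x) (λ _ → 1#) ⟨
      sum (λ x → x + 1#)           ≡⟨ sum-∘-bijection (_+ 1#) (_- 1#) (x-c+c≡x 1#) (x+c-c≡x 1#) (λ x → x) ⟩
      Σx                           ∎
      where open import Algebra.Properties.Monoid.Mult.TCOptimised using (×ᵤ≈×)

  fromℕ-^ : ∀ a k → fromℕ (a ℕ.^ k) ≡ fromℕ a ^ k
  fromℕ-^ a zero    = refl
  fromℕ-^ a (suc k) = trans (fromℕ-* a (a ℕ.^ k)) (cong (fromℕ a *_) (fromℕ-^ a k))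

  N≡p^k⇒fromℕ-p≡0 : ∀ {p k} → N ≡ p ℕ.^ k → fromℕ p ≡ 0#
  N≡p^k⇒fromℕ-p≡0 {p} {k} N≡p^k with fromℕ p FinP.≟ 0#
  ... | yes p≡0 = p≡0
  ... | no  p≢0 = ⊥-elim (^-≢0 k p≢0 (begin
    fromℕ p ^ k        ≡⟨ fromℕ-^ p k ⟨
    fromℕ (p ℕ.^ k)    ≡⟨ cong fromℕ N≡p^k ⟨
    fromℕ N            ≡⟨ fromℕ-N≡0 ⟩
    0#                 ∎))

  ∑-indicator : ∀ {n} (e : Fin n) (g : Fin n → K) → sum (λ x → if x ≡ᵇ e then g x else 0#) ≡ g e
  ∑-indicator {suc n} Fin.zero g = trans (cong (g Fin.zero +_) (∑K.sum-replicate-zero n)) (+-identityʳ _)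
  ∑-indicator (Fin.suc e)      g = trans (+-identityˡ _) (∑-indicator e (g ∘ Fin.suc))

  sumOn : Subset N → (K → K) → K
  sumOn X f = sum (λ x → if X x then f x else 0#)

  sumOn-cong : ∀ {X Y} f → (∀ x → X x ≡ Y x) → sumOn X f ≡ sumOn Y f
  sumOn-cong f X≗Y = ∑K.sum-cong-≗ {N} (λ x → cong (if_then f x else 0#) (X≗Y x))

  sumOn-+ : ∀ X f g → sumOn X (λ x → f x + g x) ≡ sumOn X f + sumOn X g
  sumOn-+ X f g = trans (∑K.sum-cong-≗ {N} split) (∑K.∑-distrib-+ {N} _ _)
    where
    split : ∀ x → (if X x then f x + g x else 0#) ≡ (if X x then f x else 0#) + (if X x then g x else 0#)
    split x with X x
    ... | true  = refl
    ... | false = sym (+-identityˡ 0#)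

  sumOn-*ˡ : ∀ X c f → sumOn X (λ x → c * f x) ≡ c * sumOn X f
  sumOn-*ˡ X c f = trans (∑K.sum-cong-≗ {N} pull) (sym (*-distribˡ-sum {N} c _))
    where
    open import Algebra.Properties.Semiring.Sum semiring using (*-distribˡ-sum)
    pull : ∀ x → (if X x then c * f x else 0#) ≡ c * (if X x then f x else 0#)
    pull x with X x
    ... | true  = refl
    ... | false = sym (zeroʳ c)

  sumOn-1 : ∀ X → sumOn X (λ _ → 1#) ≡ fromℕ ∣ X ∣
  sumOn-1 X = trans (∑K.sum-cong-≗ {N} bit) (sym (fromℕ-sum (boolToℕ ∘ X)))
    where
    bit : ∀ x → (if X x then 1# else 0#) ≡ fromℕ (boolToℕ (X x))
    bit x with X x
    ... | true  = refl
    ... | false = refl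
    module ℕSum = CommutativeMonoidSum ℕP.+-0-commutativeMonoid
    fromℕ-sum : ∀ {n} (f : Fin n → ℕ) → fromℕ (ℕSum.sum f) ≡ sum (fromℕ ∘ f)
    fromℕ-sum {zero}  f = refl
    fromℕ-sum {suc n} f = trans (fromℕ-+ (f Fin.zero) _) (cong (fromℕ (f Fin.zero) +_) (fromℕ-sum (f ∘ Fin.suc)))

  sumOn-∘-bijection : ∀ X h (f g : K → K) → (∀ x → f (g x) ≡ x) → (∀ x → g (f x) ≡ x) →
                      sumOn (X ∘ f) (h ∘ f) ≡ sumOn X h
  sumOn-∘-bijection X h f g f∘g g∘f = sum-∘-bijection f g f∘g g∘f (λ x → if X x then h x else 0#)

  sumOn-∪⁅a⁆ : ∀ X {a} f → X a ≡ false → sumOn (X ∪ ⁅ a ⁆) f ≡ sumOn X f + f a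
  sumOn-∪⁅a⁆ X {a} f a∉X =
    trans (∑K.sum-cong-≗ {N} split) (trans (∑K.∑-distrib-+ {N} _ _) (cong (sumOn X f +_) (∑-indicator a f)))
    where
    split : ∀ x → (if X x ∨ (x ≡ᵇ a) then f x else 0#) ≡ (if X x then f x else 0#) + (if x ≡ᵇ a then f x else 0#)
    split x with X x in Xx | x FinP.≟ a
    ... | false | no  _    = sym (+-identityˡ 0#)
    ... | false | yes refl = sym (+-identityˡ _)
    ... | true  | no  _    = sym (+-identityʳ _)
    ... | true  | yes refl with () ← trans (sym a∉X) Xx

  sumOn-[X+1]∪⁅e⁆ : ∀ {X C e} → (∀ x → C x ≡ ((X ∘ (_- 1#)) ∪ ⁅ e ⁆) x) → X (e - 1#) ≡ false →
                    ∀ f → sumOn C f ≡ sumOn X (λ x → f (x + 1#)) + f e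
  sumOn-[X+1]∪⁅e⁆ {X} {C} {e} C≡[X+1]∪⁅e⁆ e∉X+1 f = begin
    sumOn C f                                         ≡⟨ sumOn-cong f C≡[X+1]∪⁅e⁆ ⟩
    sumOn ((X ∘ (_- 1#)) ∪ ⁅ e ⁆) f                   ≡⟨ sumOn-∪⁅a⁆ (X ∘ (_- 1#)) f e∉X+1 ⟩
    sumOn (X ∘ (_- 1#)) f + f e
      ≡⟨ cong (_+ f e) (sumOn-∘-bijection (X ∘ (_- 1#)) f (_+ 1#) (_- 1#) (x-c+c≡x 1#) (x+c-c≡x 1#)) ⟨
    sumOn (λ x → X (x + 1# - 1#)) (λ x → f (x + 1#)) + f e
      ≡⟨ cong (_+ f e) (sumOn-cong (λ x → f (x + 1#)) (λ x → cong X (x+c-c≡x 1# x))) ⟩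
    sumOn X (λ x → f (x + 1#)) + f e                  ∎

  sumOn≡0 : ∀ X f {g c} → g ≢ 0# → (∀ x → X (g * x) ≡ X x) → (∀ x → f (g * x) ≡ c * f x) → c ≢ 1# →
            sumOn X f ≡ 0#
  sumOn≡0 X f {g} {c} g≢0 X-invariant f-homogeneous c≢1 =
    [ ⊥-elim ∘ c≢1 ∘ x-y≡0⇒x≡y , (λ S≡0 → S≡0) ]′ (x*y≡0⇒x≡0⊎y≡0 [c-1]S≡0)
    where
    g⁻¹ : K
    g⁻¹ = proj₁ (inverse g g≢0)
    S : K
    S = sumOn X f
    S≡cS : S ≡ c * S
    S≡cS = begin
      sumOn X f                                ≡⟨ sumOn-∘-bijection X f (g *_) (g⁻¹ *_)
                                                    (x*y≡1⇒x*[y*z]≡z (proj₂ (inverse g g≢0)))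
                                                    (x*y≡1⇒y*[x*z]≡z (proj₂ (inverse g g≢0))) ⟨
      sumOn (λ x → X (g * x)) (λ x → f (g * x)) ≡⟨ sumOn-cong (λ x → f (g * x)) X-invariant ⟩
      sumOn X (λ x → f (g * x))                ≡⟨ ∑K.sum-cong-≗ {N} (λ x → cong (if X x then_else 0#) (f-homogeneous x)) ⟩
      sumOn X (λ x → c * f x)                  ≡⟨ sumOn-*ˡ X c f ⟩
      c * S                                    ∎
    [c-1]S≡0 : (c - 1#) * S ≡ 0#
    [c-1]S≡0 = begin
      (c - 1#) * S     ≡⟨ solve 2 (λ c s → (c :- :1) :* s := c :* s :- s) refl c S ⟩
      c * S - S        ≡⟨ cong (_- S) S≡cS ⟨
      S - S            ≡⟨ -‿inverseʳ S ⟩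
      0#               ∎

  -- Periods of subsets

  Period : Subset N → K → Set
  Period C x = ∀ y → y ∈ C → y + x ∈ C

  Period-+ : ∀ {C x y} → Period C x → Period C y → Period C (x + y)
  Period-+ {C} {x} {y} per-x per-y z z∈C = subst (_∈ C) (+-assoc z x y) (per-y (z + x) (per-x z z∈C))

  Period-neg : ∀ {C x} → Period C x → Period C (- x)
  Period-neg {C} {x} per-x y y∈C = C+x⊆C (y - x) (subst (_∈ C) (sym (x-c+c≡x x y)) y∈C)
    where
    C+x⊆C : (λ z → C (z + x)) ⊆ C
    C+x⊆C = ⊆∧∣Y∣≤∣X∣⇒Y⊆X per-x (ℕP.≤-reflexive (∣X∘f∣≡∣X∣ C (_+ x) (_- x) (x-c+c≡x x) (x+c-c≡x x)))

  Period-* : ∀ {C g x} → g ≢ 0# → (∀ y → C (g * y) ≡ C y) → Period C x → Period C (g * x)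
  Period-* {C} {g} {x} g≢0 C-invariant per-x y y∈C =
    subst (_∈ C) g[g⁻¹y+x]≡y+gx (trans (C-invariant _) (per-x (g⁻¹ * y) g⁻¹y∈C))
    where
    g⁻¹ : K
    g⁻¹ = proj₁ (inverse g g≢0)
    gg⁻¹≡1 : g * g⁻¹ ≡ 1#
    gg⁻¹≡1 = proj₂ (inverse g g≢0)
    g⁻¹y∈C : g⁻¹ * y ∈ C
    g⁻¹y∈C = trans (sym (C-invariant _)) (trans (cong C (x*y≡1⇒x*[y*z]≡z gg⁻¹≡1 y)) y∈C)
    g[g⁻¹y+x]≡y+gx : g * (g⁻¹ * y + x) ≡ y + g * x
    g[g⁻¹y+x]≡y+gx = begin
      g * (g⁻¹ * y + x)        ≡⟨ solve 4 (λ g h y x → g :* (h :* y :+ x) := g :* (h :* y) :+ g :* x) refl g g⁻¹ y x ⟩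
      g * (g⁻¹ * y) + g * x    ≡⟨ cong (_+ g * x) (x*y≡1⇒x*[y*z]≡z gg⁻¹≡1 y) ⟩
      y + g * x                ∎

  Period-1 : ∀ {C c} → c ≢ 0# → Period C c → (∀ {x} → Period C x → Period C (c * x)) → Period C 1#
  Period-1 {C} {c} c≢0 per-c c*-closed = subst (Period C) (proj₂ (finite-order c≢0)) (per-c^[1+_] (proj₁ (finite-order c≢0)))
    where
    per-c^[1+_] : ∀ t → Period C (c ^ suc t)
    per-c^[1+ zero  ] = subst (Period C) (sym (*-identityʳ c)) per-c
    per-c^[1+ suc t ] = c*-closed per-c^[1+ t ]

  module _ {g} (g≢0 : g ≢ 0#) (g²≢1 : g * g ≢ 1#) where

    private
      g≢1 : g ≢ 1#
      g≢1 g≡1 = g²≢1 (trans (cong₂ _*_ g≡1 g≡1) (*-identityˡ 1#))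

    ∑x≡0 : ∀ {X} → (∀ x → X (g * x) ≡ X x) → sumOn X (λ x → x) ≡ 0#
    ∑x≡0 {X} X-invariant = sumOn≡0 X (λ x → x) g≢0 X-invariant (λ x → refl) g≢1

    ∑x²≡0 : ∀ {X} → (∀ x → X (g * x) ≡ X x) → sumOn X (λ x → x * x) ≡ 0#
    ∑x²≡0 {X} X-invariant = sumOn≡0 X (λ x → x * x) g≢0 X-invariant
      (λ x → solve 2 (λ g x → (g :* x) :* (g :* x) := (g :* g) :* (x :* x)) refl g x) g²≢1

    -- ∑ x and ∑ x² vanish over A and over C, so expanding both sums over C = (A + 1) ∪ {e}
    -- gives ∣A∣ + e = 0 and ∣A∣ + e² = 0.
    [A+1]∪⁅e⁆⇒e≡1 : ∀ {A C e} → (∀ x → A (g * x) ≡ A x) → (∀ x → C (g * x) ≡ C x) →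
                    (∀ x → C x ≡ ((A ∘ (_- 1#)) ∪ ⁅ e ⁆) x) → A (e - 1#) ≡ false → e ≢ 0# → e ≡ 1#
    [A+1]∪⁅e⁆⇒e≡1 {A} {C} {e} A-invariant C-invariant C≡[A+1]∪⁅e⁆ e∉A+1 e≢0 =
      [ ⊥-elim ∘ e≢0 , x-y≡0⇒x≡y ]′ (x*y≡0⇒x≡0⊎y≡0 e[e-1]≡0)
      where
      a two : K
      a   = fromℕ ∣ A ∣
      two = 1# + 1#
      sumOnC : ∀ f → sumOn C f ≡ sumOn A (λ x → f (x + 1#)) + f e
      sumOnC = sumOn-[X+1]∪⁅e⁆ C≡[A+1]∪⁅e⁆ e∉A+1
      a+e≡0 : a + e ≡ 0#
      a+e≡0 = begin
        a + e                                          ≡⟨ cong (_+ e) (+-identityˡ a) ⟨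
        0# + a + e                                     ≡⟨ cong₂ (λ u v → u + v + e) (∑x≡0 A-invariant) (sumOn-1 A) ⟨
        sumOn A (λ x → x) + sumOn A (λ _ → 1#) + e     ≡⟨ cong (_+ e) (sumOn-+ A (λ x → x) (λ _ → 1#)) ⟨
        sumOn A (λ x → x + 1#) + e                     ≡⟨ sumOnC (λ x → x) ⟨
        sumOn C (λ x → x)                              ≡⟨ ∑x≡0 C-invariant ⟩
        0#                                             ∎
      expand : sumOn A (λ x → (x + 1#) * (x + 1#)) ≡ sumOn A (λ x → x * x) + (two * sumOn A (λ x → x) + a)
      expand = begin
        sumOn A (λ x → (x + 1#) * (x + 1#))
          ≡⟨ ∑K.sum-cong-≗ {N} (λ x → cong (if A x then_else 0#)
               (solve 1 (λ x → (x :+ :1) :* (x :+ :1) := x :* x :+ ((:1 :+ :1) :* x :+ :1)) refl x)) ⟩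
        sumOn A (λ x → x * x + (two * x + 1#))
          ≡⟨ trans (sumOn-+ A _ _) (cong (sumOn A (λ x → x * x) +_) (sumOn-+ A _ _)) ⟩
        sumOn A (λ x → x * x) + (sumOn A (λ x → two * x) + sumOn A (λ _ → 1#))
          ≡⟨ cong₂ (λ u v → sumOn A (λ x → x * x) + (u + v)) (sumOn-*ˡ A two (λ x → x)) (sumOn-1 A) ⟩
        sumOn A (λ x → x * x) + (two * sumOn A (λ x → x) + a)
          ∎
      a+e²≡0 : a + e * e ≡ 0#
      a+e²≡0 = sym (begin
        0#                                                     ≡⟨ ∑x²≡0 C-invariant ⟨
        sumOn C (λ x → x * x)                                  ≡⟨ sumOnC (λ x → x * x) ⟩
        sumOn A (λ x → (x + 1#) * (x + 1#)) + e * e            ≡⟨ cong (_+ e * e) expand ⟩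
        sumOn A (λ x → x * x) + (two * sumOn A (λ x → x) + a) + e * e
          ≡⟨ cong₂ (λ u v → u + (two * v + a) + e * e) (∑x²≡0 A-invariant) (∑x≡0 A-invariant) ⟩
        0# + (two * 0# + a) + e * e
          ≡⟨ solve 3 (λ t a e → :0 :+ (t :* :0 :+ a) :+ e :* e := a :+ e :* e) refl two a e ⟩
        a + e * e                                              ∎)
      e[e-1]≡0 : e * (e - 1#) ≡ 0#
      e[e-1]≡0 = begin
        e * (e - 1#)                   ≡⟨ solve 2 (λ e a → e :* (e :- :1) := (a :+ e :* e) :- (a :+ e)) refl e a ⟩
        (a + e * e) - (a + e)          ≡⟨ cong₂ _-_ a+e²≡0 a+e≡0 ⟩
        0# - 0#                        ≡⟨ -‿inverseʳ 0# ⟩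
        0#                             ∎

module NonzeroPowers {N : ℕ} (F : FinField N) (d : ℕ) where

  open ≡ using (refl; cong; cong₂; sym; trans; subst)
  open FinFieldTheory F
  open Cardinality
  open ≡.≡-Reasoning

  -- When N - 1 = m d, H is the group of m-th roots of unity.
  H : Subset N
  H y = anyᵇ (λ x → nonzero x ∧ (x ^ d ≡ᵇ y))

  ∈H⇒power : ∀ {y} → y ∈ H → ∃ λ x → x ≢ 0# × x ^ d ≡ y
  ∈H⇒power {y} y∈H with anyᵇ-elim (λ x → nonzero x ∧ (x ^ d ≡ᵇ y)) y∈H
  ... | x , x∈ = x , ∈nonzero⇒≢0 (∧-elimˡ x∈) , ≡ᵇ⇒≡ (∧-elimʳ {nonzero x} x∈)

  power∈H : ∀ {x y} → x ≢ 0# → x ^ d ≡ y → y ∈ H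
  power∈H {x} {y} x≢0 refl =
    anyᵇ-intro (λ z → nonzero z ∧ (z ^ d ≡ᵇ x ^ d)) x (∧-intro (≢0⇒∈nonzero x≢0) (≡ᵇ-refl (x ^ d)))

  ∈H⇒≢0 : ∀ {g} → g ∈ H → g ≢ 0#
  ∈H⇒≢0 g∈H with ∈H⇒power g∈H
  ... | x , x≢0 , refl = ^-≢0 d x≢0

  1∈H : 1# ∈ H
  1∈H = power∈H 1≢0 (1^n≡1 d)

  *-∈H : ∀ {g h} → g ∈ H → h ∈ H → g * h ∈ H
  *-∈H g∈H h∈H with ∈H⇒power g∈H | ∈H⇒power h∈H
  ... | x , x≢0 , refl | y , y≢0 , refl = power∈H (x≢0∧y≢0⇒x*y≢0 x≢0 y≢0) (^-distrib-* x y d)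

  ∈H⇒inverse∈H : ∀ {g} → g ∈ H → ∃ λ g′ → g′ ∈ H × g * g′ ≡ 1#
  ∈H⇒inverse∈H g∈H with ∈H⇒power g∈H
  ... | x , x≢0 , refl with inverse x x≢0
  ...   | x′ , xx′≡1 = x′ ^ d , power∈H (x*y≡1⇒y≢0 xx′≡1) refl ,
                       trans (sym (^-distrib-* x x′ d)) (trans (cong (_^ d) xx′≡1) (1^n≡1 d))

  ∣nonzero∣≤d*∣H∣ : 1 ℕ.≤ d → ∣ nonzero ∣ ℕ.≤ d ℕ.* ∣ H ∣
  ∣nonzero∣≤d*∣H∣ (ℕ.s≤s {n = e} _) =
    ∣fibre∣≤s⇒∣X∣≤s*∣Y∣ (_^ d) d (λ x x∈ → power∈H (∈nonzero⇒≢0 x∈) refl) ∣fibre∣≤d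
    where
    ∣fibre∣≤d : ∀ y → ∣ nonzero ∩ (⁅ y ⁆ ∘ (_^ d)) ∣ ℕ.≤ d
    ∣fibre∣≤d y with y FinP.≟ 0#
    ... | yes refl = ℕP.≤-trans (ℕP.≤-reflexive (∅⇒∣X∣≡0 _ no-root)) ℕ.z≤n
      where
      no-root : ∀ x → (nonzero x ∧ (x ^ d ≡ᵇ 0#)) ≡ false
      no-root x with x FinP.≟ 0#
      ... | yes refl = refl
      ... | no  x≢0  = ≢⇒≡ᵇ-false (^-≢0 d x≢0)
    ... | no  y≢0  = ℕP.≤-trans (⊆⇒∣∣-≤ (λ x → ∧-elimʳ {nonzero x})) (∣x^[1+e]≡c∣≤1+e e y≢0)

  Invariant : Subset N → Set
  Invariant X = ∀ {g} → g ∈ H → ∀ y → X (g * y) ≡ X y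

  invariant : ∀ {X} → (∀ {g y} → g ∈ H → y ∈ X → g * y ∈ X) → Invariant X
  invariant {X} closed {g} g∈H y = ≡true-ext (λ gy∈X → subst (_∈ X) (g′[gy]≡y) (closed g′∈H gy∈X)) (closed g∈H)
    where
    g′ : K
    g′ = proj₁ (∈H⇒inverse∈H g∈H)
    g′∈H : g′ ∈ H
    g′∈H = proj₁ (proj₂ (∈H⇒inverse∈H g∈H))
    g′[gy]≡y : g′ * (g * y) ≡ y
    g′[gy]≡y = x*y≡1⇒y*[x*z]≡z (proj₂ (proj₂ (∈H⇒inverse∈H g∈H))) y

  orbit : K → Subset N
  orbit x y = anyᵇ (λ g → H g ∧ (x * g ≡ᵇ y))

  orbit-intro : ∀ {x y} g → g ∈ H → x * g ≡ y → y ∈ orbit x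
  orbit-intro {x} g g∈H refl = anyᵇ-intro (λ h → H h ∧ (x * h ≡ᵇ x * g)) g (∧-intro g∈H (≡ᵇ-refl (x * g)))

  orbit-elim : ∀ {x y} → y ∈ orbit x → ∃ λ g → g ∈ H × x * g ≡ y
  orbit-elim {x} {y} y∈xH with anyᵇ-elim (λ g → H g ∧ (x * g ≡ᵇ y)) y∈xH
  ... | g , g∈ = g , ∧-elimˡ g∈ , ≡ᵇ⇒≡ (∧-elimʳ {H g} g∈)

  orbit-refl : ∀ x → x ∈ orbit x
  orbit-refl x = orbit-intro 1# 1∈H (*-identityʳ x)

  orbit-sym : ∀ {x y} → y ∈ orbit x → x ∈ orbit y
  orbit-sym {x} y∈xH with orbit-elim y∈xH
  ... | g , g∈H , refl with ∈H⇒inverse∈H g∈H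
  ...   | g′ , g′∈H , gg′≡1 = orbit-intro g′ g′∈H (begin
    x * g * g′      ≡⟨ *-assoc x g g′ ⟩
    x * (g * g′)    ≡⟨ cong (x *_) gg′≡1 ⟩
    x * 1#          ≡⟨ *-identityʳ x ⟩
    x               ∎)

  orbit-trans : ∀ {x y z} → y ∈ orbit x → z ∈ orbit y → z ∈ orbit x
  orbit-trans {x} y∈xH z∈yH with orbit-elim y∈xH | orbit-elim z∈yH
  ... | g , g∈H , refl | h , h∈H , refl = orbit-intro (g * h) (*-∈H g∈H h∈H) (sym (*-assoc x g h))

  ∣orbit∣≡∣H∣ : ∀ {x} → x ≢ 0# → ∣ orbit x ∣ ≡ ∣ H ∣
  ∣orbit∣≡∣H∣ {x} x≢0 with inverse x x≢0
  ... | x′ , xx′≡1 =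
    trans (∣∣-cong orbit≡H∘x′*) (∣X∘f∣≡∣X∣ H (x′ *_) (x *_) (x*y≡1⇒y*[x*z]≡z xx′≡1) (x*y≡1⇒x*[y*z]≡z xx′≡1))
    where
    orbit≡H∘x′* : ∀ y → orbit x y ≡ H (x′ * y)
    orbit≡H∘x′* y = ≡true-ext to from
      where
      to : y ∈ orbit x → x′ * y ∈ H
      to y∈xH with orbit-elim y∈xH
      ... | g , g∈H , refl = subst (_∈ H) (sym (x*y≡1⇒y*[x*z]≡z xx′≡1 g)) g∈H
      from : x′ * y ∈ H → y ∈ orbit x
      from x′y∈H = orbit-intro (x′ * y) x′y∈H (x*y≡1⇒x*[y*z]≡z xx′≡1 y)

  ∣H∣∣∣X∣ : ∀ {X} → Invariant X → X 0# ≡ false → ∣ H ∣ ∣ ∣ X ∣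
  ∣H∣∣∣X∣ {X} X-invariant 0∉X = classSize∣∣X∣ orbit orbit-refl orbit-sym orbit-trans ∣ H ∣ saturated
    (λ {x} x∈X → ∣orbit∣≡∣H∣ (λ { refl → ⊥-elim (true≢false (trans (sym x∈X) 0∉X)) }))
    where
    true≢false : true ≢ false
    true≢false ()
    saturated : ∀ {x y} → x ∈ X → y ∈ orbit x → y ∈ X
    saturated {x} x∈X y∈xH with orbit-elim y∈xH
    ... | g , g∈H , refl = trans (cong X (*-comm x g)) (trans (X-invariant g∈H x) x∈X)

  -- Sums of elements of H

  Sums : ℕ → Subset N
  Sums zero    y = y ≡ᵇ 0#
  Sums (suc j) y = anyᵇ (λ g → H g ∧ Sums j (y - g))

  0∈Sums0 : 0# ∈ Sums 0
  0∈Sums0 = ≡ᵇ-refl 0#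

  Sums-intro : ∀ j {g z y} → g ∈ H → z ∈ Sums j → y ≡ z + g → y ∈ Sums (suc j)
  Sums-intro j {g} {z} g∈H z∈ refl =
    anyᵇ-intro (λ h → H h ∧ Sums j (z + g - h)) g (∧-intro g∈H (subst (_∈ Sums j) (sym (x+c-c≡x g z)) z∈))

  Sums-elim : ∀ j {y} → y ∈ Sums (suc j) → ∃ λ g → g ∈ H × y - g ∈ Sums j
  Sums-elim j {y} y∈ with anyᵇ-elim (λ g → H g ∧ Sums j (y - g)) y∈
  ... | g , g∈ = g , ∧-elimˡ g∈ , ∧-elimʳ {H g} g∈

  ∈Sums⇒sum-of-powers : ∀ j {y} → y ∈ Sums j →
                        ∃ λ (x : Fin j → K) → (∀ i → x i ≢ 0#) × sum (λ i → x i ^ d) ≡ y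
  ∈Sums⇒sum-of-powers zero    y∈ = (λ ()) , (λ ()) , sym (≡ᵇ⇒≡ y∈)
  ∈Sums⇒sum-of-powers (suc j) {y} y∈ with Sums-elim j y∈
  ... | g , g∈H , y-g∈ with ∈H⇒power g∈H | ∈Sums⇒sum-of-powers j y-g∈
  ...   | x₀ , x₀≢0 , refl | x , x≢0 , ∑≡y-g =
    (λ { Fin.zero → x₀ ; (Fin.suc i) → x i }) , (λ { Fin.zero → x₀≢0 ; (Fin.suc i) → x≢0 i }) ,
    trans (cong (x₀ ^ d +_) ∑≡y-g) (solve 2 (λ a y → a :+ (y :- a) := y) refl (x₀ ^ d) y)

  Sums-invariant : ∀ j → Invariant (Sums j)
  Sums-invariant j = invariant (closed j)
    where
    closed : ∀ j {g y} → g ∈ H → y ∈ Sums j → g * y ∈ Sums j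
    closed zero    {g} g∈H y∈ = ≡⇒≡ᵇ (trans (cong (g *_) (≡ᵇ⇒≡ y∈)) (zeroʳ g))
    closed (suc j) {g} {y} g∈H y∈ with Sums-elim j y∈
    ... | h , h∈H , y-h∈ = Sums-intro j (*-∈H g∈H h∈H) (closed j g∈H y-h∈)
                              (solve 3 (λ g y h → g :* y := g :* (y :- h) :+ g :* h) refl g y h)

  Sums-nonempty : ∀ j → ∃ (_∈ Sums j)
  Sums-nonempty zero    = 0# , 0∈Sums0
  Sums-nonempty (suc j) with Sums-nonempty j
  ... | y , y∈ = y + 1# , Sums-intro j 1∈H y∈ refl

  Sums-+ : ∀ a b {y z} → y ∈ Sums a → z ∈ Sums b → y + z ∈ Sums (a ℕ.+ b)
  Sums-+ zero    b {y} {z} y∈ z∈ = subst (_∈ Sums b) (trans (sym (+-identityˡ z)) (cong (_+ z) (sym (≡ᵇ⇒≡ y∈)))) z∈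
  Sums-+ (suc a) b {y} {z} y∈ z∈ with Sums-elim a y∈
  ... | g , g∈H , y-g∈ = Sums-intro (a ℕ.+ b) g∈H (Sums-+ a b y-g∈ z∈)
                           (solve 3 (λ y z g → y :+ z := (y :- g) :+ z :+ g) refl y z g)

  H⊆Sums1 : ∀ {g} → g ∈ H → g ∈ Sums 1
  H⊆Sums1 {g} g∈H = Sums-intro 0 g∈H 0∈Sums0 (sym (+-identityˡ g))

  fromℕ[j]∈Sums[j] : ∀ j → fromℕ j ∈ Sums j
  fromℕ[j]∈Sums[j] zero    = 0∈Sums0
  fromℕ[j]∈Sums[j] (suc j) = Sums-intro j 1∈H (fromℕ[j]∈Sums[j] j) (trans (cong fromℕ (ℕP.+-comm 1 j)) (fromℕ-+ j 1))

  0∈Sums2⇒0∈Sums[t+t] : 0# ∈ Sums 2 → ∀ t → 0# ∈ Sums (t ℕ.+ t)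
  0∈Sums2⇒0∈Sums[t+t] 0∈S₂ zero    = 0∈Sums0
  0∈Sums2⇒0∈Sums[t+t] 0∈S₂ (suc t) = subst (λ k → 0# ∈ Sums k) (cong suc (sym (ℕP.+-suc t t)))
    (subst (_∈ Sums (2 ℕ.+ (t ℕ.+ t))) (+-identityˡ 0#) (Sums-+ 2 (t ℕ.+ t) 0∈S₂ (0∈Sums2⇒0∈Sums[t+t] 0∈S₂ t)))

  H-Periodic : Subset N → Set
  H-Periodic C = ∀ {g} → g ∈ H → Period C g

  H-periodic⇒Period[-y] : ∀ {C} → H-Periodic C → ∀ i {y} → y ∈ Sums i → Period C (- y)
  H-periodic⇒Period[-y] {C} periodic zero    {y} y∈ z z∈C = subst (_∈ C) (sym z-y≡z) z∈C
    where
    z-y≡z : z + - y ≡ z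
    z-y≡z = begin
      z + - y     ≡⟨ cong (λ u → z + - u) (≡ᵇ⇒≡ y∈) ⟩
      z + - 0#    ≡⟨ cong (z +_) -0#≈0# ⟩
      z + 0#      ≡⟨ +-identityʳ z ⟩
      z           ∎
  H-periodic⇒Period[-y] {C} periodic (suc i) {y} y∈ with Sums-elim i y∈
  ... | g , g∈H , y-g∈ = subst (Period C) (solve 2 (λ y g → :- (y :- g) :+ :- g := :- y) refl y g)
                            (Period-+ (H-periodic⇒Period[-y] periodic i y-g∈) (Period-neg (periodic g∈H)))

  H-periodic⇒0∈Sums[j] : ∀ {j} → H-Periodic (Sums j) → 0# ∈ Sums j
  H-periodic⇒0∈Sums[j] {j} periodic with Sums-nonempty j
  ... | y , y∈ = subst (_∈ Sums j) (-‿inverseʳ y) (H-periodic⇒Period[-y] periodic j y∈ y y∈)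

  H-periodic⇒Sums[1+j]≡Sums[j] : ∀ {j} → H-Periodic (Sums j) → ∀ y → Sums (suc j) y ≡ Sums j y
  H-periodic⇒Sums[1+j]≡Sums[j] {j} periodic y = ≡true-ext to from
    where
    to : y ∈ Sums (suc j) → y ∈ Sums j
    to y∈ with Sums-elim j y∈
    ... | g , g∈H , y-g∈ = subst (_∈ Sums j) (x-c+c≡x g y) (periodic g∈H (y - g) y-g∈)
    from : y ∈ Sums j → y ∈ Sums (suc j)
    from y∈ = Sums-intro j 1∈H (H-periodic⇒Period[-y] periodic 1 (H⊆Sums1 1∈H) y y∈) (sym (x-c+c≡x 1# y))

  H-periodic⇒0∈Sums : ∀ {j} → H-Periodic (Sums j) → ∀ t → 0# ∈ Sums (j ℕ.+ t)
  H-periodic⇒0∈Sums {j} periodic t = trans (Sums[j+t]≡Sums[j] t 0#) (H-periodic⇒0∈Sums[j] {j} periodic)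
    where
    Sums[j+t]≡Sums[j] : ∀ t y → Sums (j ℕ.+ t) y ≡ Sums j y
    Sums[j+t]≡Sums[j] zero    y = cong (λ k → Sums k y) (ℕP.+-identityʳ j)
    Sums[j+t]≡Sums[j] (suc t) y = begin
      Sums (j ℕ.+ suc t) y                          ≡⟨ cong (λ k → Sums k y) (ℕP.+-suc j t) ⟩
      anyᵇ (λ g → H g ∧ Sums (j ℕ.+ t) (y - g))
        ≡⟨ anyᵇ-cong (λ g → cong (H g ∧_) (Sums[j+t]≡Sums[j] t (y - g))) ⟩
      Sums (suc j) y                                ≡⟨ H-periodic⇒Sums[1+j]≡Sums[j] {j} periodic y ⟩
      Sums j y                                      ∎

  module _ {h₀} (h₀∈H : h₀ ∈ H) (h₀≢1 : h₀ ≢ 1#) where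

    -- The periods of C form an additive group stable under multiplication by c = 1 - h₀ ≠ 0,
    -- and a finite order of c puts 1 among them.
    Period[1-h]⇒H-periodic : ∀ {C} → Invariant C → (∀ {h} → h ∈ H → Period C (1# - h)) → H-Periodic C
    Period[1-h]⇒H-periodic {C} C-invariant per[1-h] {g} g∈H =
      subst (Period C) (*-identityʳ g) (Period-* (∈H⇒≢0 g∈H) (C-invariant g∈H) per-1)
      where
      c : K
      c = 1# - h₀
      c≢0 : c ≢ 0#
      c≢0 c≡0 = h₀≢1 (sym (x-y≡0⇒x≡y c≡0))
      c*-closed : ∀ {x} → Period C x → Period C (c * x)
      c*-closed {x} per-x = subst (Period C) (solve 2 (λ h x → x :+ :- (h :* x) := (:1 :- h) :* x) refl h₀ x)
        (Period-+ per-x (Period-neg (Period-* (∈H⇒≢0 h₀∈H) (C-invariant h₀∈H) per-x)))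
      per-1 : Period C 1#
      per-1 = Period-1 c≢0 (per[1-h] h₀∈H) c*-closed

  module _ (j : ℕ) where

    private
      A C A+1 : Subset N
      A = Sums j
      C = Sums (suc j)
      A+1 y = A (y - 1#)

      A+1⊆C : A+1 ⊆ C
      A+1⊆C y y-1∈A = Sums-intro j 1∈H y-1∈A (sym (x-c+c≡x 1# y))

      ∣A+1∣≡∣A∣ : ∣ A+1 ∣ ≡ ∣ A ∣
      ∣A+1∣≡∣A∣ = ∣X∘f∣≡∣X∣ A (_- 1#) (_+ 1#) (x+c-c≡x 1#) (x-c+c≡x 1#)

      h⁻¹y∈A+1⇒y+[1-h]∈C : ∀ {h h′ y} → h ∈ H → h * h′ ≡ 1# → h′ * y ∈ A+1 → y + (1# - h) ∈ C
      h⁻¹y∈A+1⇒y+[1-h]∈C {h} {h′} {y} h∈H hh′≡1 h′y-1∈A =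
        Sums-intro j 1∈H (trans (Sums-invariant j h∈H _) h′y-1∈A) y+[1-h]≡h[h′y-1]+1
        where
        y+[1-h]≡h[h′y-1]+1 : y + (1# - h) ≡ h * (h′ * y - 1#) + 1#
        y+[1-h]≡h[h′y-1]+1 = begin
          y + (1# - h)                  ≡⟨ cong (λ u → u + (1# - h)) (x*y≡1⇒x*[y*z]≡z hh′≡1 y) ⟨
          h * (h′ * y) + (1# - h)
            ≡⟨ solve 2 (λ h h′y → h :* h′y :+ (:1 :- h) := h :* (h′y :- :1) :+ :1) refl h (h′ * y) ⟩
          h * (h′ * y - 1#) + 1#        ∎

      0∈C⇒0∈A+1 : 0# ∈ C → 0# ∈ A+1
      0∈C⇒0∈A+1 0∈C with Sums-elim j 0∈C
      ... | g , g∈H , -g∈A with ∈H⇒inverse∈H g∈H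
      ...   | g′ , g′∈H , gg′≡1 = subst (_∈ A) g′[0-g]≡0-1 (trans (Sums-invariant j g′∈H _) -g∈A)
        where
        g′[0-g]≡0-1 : g′ * (0# - g) ≡ 0# - 1#
        g′[0-g]≡0-1 = begin
          g′ * (0# - g)     ≡⟨ solve 2 (λ g′ g → g′ :* (:0 :- g) := :0 :- g :* g′) refl g′ g ⟩
          0# - g * g′       ≡⟨ cong (λ u → 0# - u) gg′≡1 ⟩
          0# - 1#           ∎

    -- At most one point of Sums (1 + j) lies outside Sums j + 1, and the power sums force it to be 1.
    ∣Sums[1+j]∣≤1+∣Sums[j]∣⇒Period[1-h] : ∀ {g₀} → g₀ ∈ H → g₀ * g₀ ≢ 1# → ∣ C ∣ ℕ.≤ suc ∣ A ∣ →
                                          ∀ {h} → h ∈ H → Period C (1# - h)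
    ∣Sums[1+j]∣≤1+∣Sums[j]∣⇒Period[1-h] {g₀} g₀∈H g₀²≢1 ∣C∣≤1+∣A∣ {h} h∈H y y∈C
      with ∈H⇒inverse∈H h∈H
    ... | h′ , h′∈H , hh′≡1 with A+1 (h′ * y) in h′y∈A+1
    ...   | true  = h⁻¹y∈A+1⇒y+[1-h]∈C h∈H hh′≡1 h′y∈A+1
    ...   | false = subst (_∈ C) 1≡y+[1-h] 1∈C
      where
      e : K
      e = h′ * y
      e∈C : e ∈ C
      e∈C = trans (Sums-invariant (suc j) h′∈H y) y∈C
      e∈C∖A+1 : e ∈ C ∖ A+1
      e∈C∖A+1 = ∧-intro e∈C (cong not h′y∈A+1)
      ∣C∖A+1∣≤1 : ∣ C ∖ A+1 ∣ ℕ.≤ 1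
      ∣C∖A+1∣≤1 =
        ℕP.+-cancelˡ-≤ ∣ A ∣ _ _ (≡.subst₂ ℕ._≤_ ∣C∣≡∣A∣+∣C∖A+1∣ (ℕP.+-comm 1 ∣ A ∣) ∣C∣≤1+∣A∣)
        where
        ∣C∣≡∣A∣+∣C∖A+1∣ : ∣ C ∣ ≡ ∣ A ∣ ℕ.+ ∣ C ∖ A+1 ∣
        ∣C∣≡∣A∣+∣C∖A+1∣ = trans (⊆⇒∣Y∣≡∣X∣+∣Y∖X∣ A+1⊆C) (cong (ℕ._+ ∣ C ∖ A+1 ∣) ∣A+1∣≡∣A∣)
      e≢0 : e ≢ 0#
      e≢0 e≡0 = false⇒∉ {X = A+1} h′y∈A+1 (subst (_∈ A+1) (sym e≡0) (0∈C⇒0∈A+1 (subst (_∈ C) e≡0 e∈C)))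
      e≡1 : e ≡ 1#
      e≡1 = [A+1]∪⁅e⁆⇒e≡1 (∈H⇒≢0 g₀∈H) g₀²≢1 (Sums-invariant j g₀∈H) (Sums-invariant (suc j) g₀∈H)
              (∣Y∖X∣≤1⇒Y≡X∪⁅e⁆ A+1⊆C ∣C∖A+1∣≤1 e∈C∖A+1) h′y∈A+1 e≢0
      1∈C : 1# ∈ C
      1∈C = subst (_∈ C) e≡1 e∈C
      1≡y+[1-h] : 1# ≡ y + (1# - h)
      1≡y+[1-h] = begin
        1#                       ≡⟨ solve 1 (λ h → :1 := h :+ (:1 :- h)) refl h ⟩
        h + (1# - h)             ≡⟨ cong (λ u → u + (1# - h)) (trans (sym (*-identityʳ h)) (cong (h *_) (sym e≡1))) ⟩
        h * (h′ * y) + (1# - h)  ≡⟨ cong (λ u → u + (1# - h)) (x*y≡1⇒x*[y*z]≡z hh′≡1 y) ⟩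
        y + (1# - h)             ∎

  ∖⁅0⁆-invariant : ∀ {X} → Invariant X → Invariant (X ∖ ⁅ 0# ⁆)
  ∖⁅0⁆-invariant {X} X-invariant {g} g∈H y = cong₂ (λ u v → u ∧ not v) (X-invariant g∈H y) gy≡0≡y≡0
    where
    gy≡0≡y≡0 : (g * y ≡ᵇ 0#) ≡ (y ≡ᵇ 0#)
    gy≡0≡y≡0 with y FinP.≟ 0#
    ... | yes refl = ≡⇒≡ᵇ (zeroʳ g)
    ... | no  y≢0  = ≢⇒≡ᵇ-false (x≢0∧y≢0⇒x*y≢0 (∈H⇒≢0 g∈H) y≢0)

  0∉X∖⁅0⁆ : ∀ X → (X ∖ ⁅ 0# ⁆) 0# ≡ false
  0∉X∖⁅0⁆ X rewrite ≡ᵇ-refl 0# = BoolP.∧-zeroʳ (X 0#)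

  module _ {g₀} (g₀∈H : g₀ ∈ H) (g₀²≢1 : g₀ * g₀ ≢ 1#) where

    private
      g₀≢1 : g₀ ≢ 1#
      g₀≢1 g₀≡1 = g₀²≢1 (trans (cong₂ _*_ g₀≡1 g₀≡1) (*-identityˡ 1#))

    -- Sizes of H-invariant sets avoiding 0 are multiples of ∣H∣, so growth by less than ∣H∣ is
    -- growth by at most the one element 0.
    grows-or-periodic : ∀ j → H-Periodic (Sums (suc j)) ⊎
                                ∣ Sums j ∖ ⁅ 0# ⁆ ∣ ℕ.+ ∣ H ∣ ℕ.≤ ∣ Sums (suc j) ∖ ⁅ 0# ⁆ ∣
    grows-or-periodic j with ∣ Sums j ∖ ⁅ 0# ⁆ ∣ ℕ.+ ∣ H ∣ ℕ.≤? ∣ Sums (suc j) ∖ ⁅ 0# ⁆ ∣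
    ... | yes grows     = inj₂ grows
    ... | no  ¬grows    = inj₁ (Period[1-h]⇒H-periodic g₀∈H g₀≢1 (Sums-invariant (suc j))
                                  (∣Sums[1+j]∣≤1+∣Sums[j]∣⇒Period[1-h] j g₀∈H g₀²≢1 ∣C∣≤1+∣A∣))
      where
      A C : Subset N
      A = Sums j
      C = Sums (suc j)
      ∣H∣∣∣X∖0∣ : ∀ i → ∣ H ∣ ∣ ∣ Sums i ∖ ⁅ 0# ⁆ ∣
      ∣H∣∣∣X∖0∣ i = ∣H∣∣∣X∣ (∖⁅0⁆-invariant (Sums-invariant i)) (0∉X∖⁅0⁆ (Sums i))
      ∣C∖0∣≤∣A∖0∣ : ∣ C ∖ ⁅ 0# ⁆ ∣ ℕ.≤ ∣ A ∖ ⁅ 0# ⁆ ∣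
      ∣C∖0∣≤∣A∖0∣ = m∣n∧m∣o∧o<n+m⇒o≤n (∣H∣∣∣X∖0∣ j) (∣H∣∣∣X∖0∣ (suc j)) (ℕP.≰⇒> ¬grows)
      ∣C∣≤1+∣A∣ : ∣ C ∣ ℕ.≤ suc ∣ A ∣
      ∣C∣≤1+∣A∣ = ≡.subst₂ ℕ._≤_ (sym (∣X∣≡∣X∖⁅a⁆∣+[a∈X] C 0#)) (ℕP.+-comm ∣ A ∣ 1)
                   (ℕP.+-mono-≤ (ℕP.≤-trans ∣C∖0∣≤∣A∖0∣ (⊆⇒∣∣-≤ {X = A ∖ ⁅ 0# ⁆} {A} (λ x → ∧-elimˡ)))
                                 (bit≤1 (C 0#)))
        where
        bit≤1 : ∀ b → boolToℕ b ℕ.≤ 1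
        bit≤1 true  = ℕP.≤-refl
        bit≤1 false = ℕ.z≤n

    periodic-or-large : ∀ j → (∃ λ i → i ℕ.≤ suc j × H-Periodic (Sums i)) ⊎
                              suc j ℕ.* ∣ H ∣ ℕ.≤ ∣ Sums (suc j) ∖ ⁅ 0# ⁆ ∣
    periodic-or-large zero =
      inj₂ (subst (ℕ._≤ ∣ Sums 1 ∖ ⁅ 0# ⁆ ∣) (sym (ℕP.+-identityʳ ∣ H ∣)) (⊆⇒∣∣-≤ H⊆Sums1∖0))
      where
      H⊆Sums1∖0 : H ⊆ Sums 1 ∖ ⁅ 0# ⁆
      H⊆Sums1∖0 g g∈H = ∧-intro (H⊆Sums1 g∈H) (cong not (≢⇒≡ᵇ-false (∈H⇒≢0 g∈H)))
    periodic-or-large (suc j) with periodic-or-large j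
    ... | inj₁ (i , i≤1+j , periodic) = inj₁ (i , ℕP.m≤n⇒m≤1+n i≤1+j , periodic)
    ... | inj₂ large with grows-or-periodic (suc j)
    ...   | inj₁ periodic = inj₁ (suc (suc j) , ℕP.≤-refl , periodic)
    ...   | inj₂ grows    =
      inj₂ (ℕP.≤-trans (ℕP.≤-reflexive (ℕP.+-comm ∣ H ∣ _)) (ℕP.≤-trans (ℕP.+-monoˡ-≤ ∣ H ∣ large) grows))

    ∣nonzero∣<n*∣H∣⇒0∈Sums : ∀ n → ∣ nonzero ∣ ℕ.< n ℕ.* ∣ H ∣ → 0# ∈ Sums n
    ∣nonzero∣<n*∣H∣⇒0∈Sums zero    ()
    ∣nonzero∣<n*∣H∣⇒0∈Sums (suc j) small with periodic-or-large j
    ... | inj₁ (i , i≤1+j , periodic) =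
      subst (λ k → 0# ∈ Sums k) (ℕP.m+[n∸m]≡n i≤1+j) (H-periodic⇒0∈Sums {i} periodic (suc j ℕ.∸ i))
    ... | inj₂ large = ⊥-elim (ℕP.<⇒≱ small (ℕP.≤-trans large
      (⊆⇒∣∣-≤ {X = Sums (suc j) ∖ ⁅ 0# ⁆} {nonzero} (λ x → ∧-elimʳ {Sums (suc j) x}))))

  module _ (g²≡1 : ∀ {g} → g ∈ H → g * g ≡ 1#) where

    ∣H∣≤2 : ∣ H ∣ ℕ.≤ 2
    ∣H∣≤2 = ℕP.≤-trans (⊆⇒∣∣-≤ H⊆roots) (∣x^[1+e]≡c∣≤1+e 1 1≢0)
      where
      H⊆roots : H ⊆ (λ x → x ^ 2 ≡ᵇ 1#)
      H⊆roots x x∈H = ≡⇒≡ᵇ (trans (cong (x *_) (*-identityʳ x)) (g²≡1 x∈H))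

    2≤∣H∣⇒−1∈H : 2 ℕ.≤ ∣ H ∣ → ∃ λ g → g ∈ H × g ≢ 1# × g + 1# ≡ 0#
    2≤∣H∣⇒−1∈H 2≤∣H∣ with 1≤∣X∣⇒∈ (H ∖ ⁅ 1# ⁆) 1≤∣H∖1∣
      where
      1≤∣H∖1∣ : 1 ℕ.≤ ∣ H ∖ ⁅ 1# ⁆ ∣
      1≤∣H∖1∣ = ℕP.+-cancelʳ-≤ 1 1 _ (subst (2 ℕ.≤_) ∣H∣≡∣H∖1∣+1 2≤∣H∣)
        where
        ∣H∣≡∣H∖1∣+1 : ∣ H ∣ ≡ ∣ H ∖ ⁅ 1# ⁆ ∣ ℕ.+ 1
        ∣H∣≡∣H∖1∣+1 = trans (∣X∣≡∣X∖⁅a⁆∣+[a∈X] H 1#) (cong (λ b → ∣ H ∖ ⁅ 1# ⁆ ∣ ℕ.+ boolToℕ b) 1∈H)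
    ... | g , g∈H∖1 = g , g∈H , g≢1 , g+1≡0
      where
      g∈H : g ∈ H
      g∈H = ∧-elimˡ {H g} g∈H∖1
      g≢1 : g ≢ 1#
      g≢1 g≡1 = false⇒∉ {X = ⁅ 1# ⁆} {g} (∈∖⇒∉ {X = H} {⁅ 1# ⁆} g∈H∖1) (≡⇒≡ᵇ g≡1)
      g+1≡0 : g + 1# ≡ 0#
      g+1≡0 with x*y≡0⇒x≡0⊎y≡0 [g-1][g+1]≡0
        where
        [g-1][g+1]≡0 : (g - 1#) * (g + 1#) ≡ 0#
        [g-1][g+1]≡0 = begin
          (g - 1#) * (g + 1#)    ≡⟨ solve 1 (λ g → (g :- :1) :* (g :+ :1) := g :* g :- :1) refl g ⟩
          g * g - 1#             ≡⟨ cong (_- 1#) (g²≡1 g∈H) ⟩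
          1# - 1#                ≡⟨ -‿inverseʳ 1# ⟩
          0#                     ∎
      ... | inj₁ g-1≡0 = ⊥-elim (g≢1 (x-y≡0⇒x≡y g-1≡0))
      ... | inj₂ g+1≡0 = g+1≡0

  −1∈H⇒0∈Sums2 : ∀ {g} → g ∈ H → g + 1# ≡ 0# → 0# ∈ Sums 2
  −1∈H⇒0∈Sums2 {g} g∈H g+1≡0 = Sums-intro 1 g∈H (H⊆Sums1 1∈H) (sym (trans (+-comm 1# g) g+1≡0))

  0∈Sums2∧0∈Sums[1+2s]⇒0∈Sums : ∀ {s n} → 0# ∈ Sums 2 → 0# ∈ Sums (suc (s ℕ.+ s)) →
                                suc (s ℕ.+ s) ℕ.≤ n → 0# ∈ Sums n
  0∈Sums2∧0∈Sums[1+2s]⇒0∈Sums {s} {n} 0∈S₂ 0∈S[1+2s] 1+2s≤n with even-or-odd n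
  ... | t , inj₁ refl = 0∈Sums2⇒0∈Sums[t+t] 0∈S₂ t
  ... | t , inj₂ refl = subst (λ k → 0# ∈ Sums k) 1+2s+[u+u]≡1+t+t 0∈S[1+2s+[u+u]]
    where
    u : ℕ
    u = t ℕ.∸ s
    0∈S[1+2s+[u+u]] : 0# ∈ Sums (suc (s ℕ.+ s) ℕ.+ (u ℕ.+ u))
    0∈S[1+2s+[u+u]] = subst (_∈ Sums (suc (s ℕ.+ s) ℕ.+ (u ℕ.+ u))) (+-identityˡ 0#)
                        (Sums-+ (suc (s ℕ.+ s)) (u ℕ.+ u) 0∈S[1+2s] (0∈Sums2⇒0∈Sums[t+t] 0∈S₂ u))
    s≤t : s ℕ.≤ t
    s≤t = ℕP.≮⇒≥ (λ t<s → ℕP.<⇒≱ (ℕP.+-mono-< t<s t<s) (ℕP.≤-pred 1+2s≤n))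
    1+2s+[u+u]≡1+t+t : suc (s ℕ.+ s) ℕ.+ (u ℕ.+ u) ≡ suc (t ℕ.+ t)
    1+2s+[u+u]≡1+t+t = cong suc (begin
      s ℕ.+ s ℕ.+ (u ℕ.+ u)     ≡⟨ ℕP.+-assoc s s (u ℕ.+ u) ⟩
      s ℕ.+ (s ℕ.+ (u ℕ.+ u))   ≡⟨ cong (s ℕ.+_) (trans (sym (ℕP.+-assoc s u u)) (ℕP.+-comm (s ℕ.+ u) u)) ⟩
      s ℕ.+ (u ℕ.+ (s ℕ.+ u))   ≡⟨ ℕP.+-assoc s u (s ℕ.+ u) ⟨
      (s ℕ.+ u) ℕ.+ (s ℕ.+ u)   ≡⟨ cong₂ ℕ._+_ s+u≡t s+u≡t ⟩
      t ℕ.+ t                   ∎)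
      where
      s+u≡t : s ℕ.+ u ≡ t
      s+u≡t = ℕP.m+[n∸m]≡n s≤t

module FinFieldOfCard {c ℓ} (K : CommutativeRing c ℓ) {N : ℕ} (card : HasCard K N) where

  open CommutativeRing K
  open FieldOps K using (_^_; sum)
  private module I = Inverse (Bijection⇒Inverse card)

  fromFin : Fin N → Carrier
  fromFin = I.from

  fromFin-injective : ∀ {i j} → fromFin i ≈ fromFin j → i ≡ j
  fromFin-injective {i} {j} e =
    ≡.trans (≡.sym (I.strictlyInverseˡ i)) (≡.trans (I.to-cong e) (I.strictlyInverseˡ j))

  finRawRing : RawRing 0ℓ 0ℓ
  finRawRing = record
    { Carrier = Fin N ; _≈_ = _≡_
    ; _+_ = λ a b → I.to (fromFin a + fromFin b) ; _*_ = λ a b → I.to (fromFin a * fromFin b)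
    ; -_ = λ a → I.to (- fromFin a) ; 0# = I.to 0# ; 1# = I.to 1# }

  open RawRing finRawRing using () renaming (_*_ to _⊛_; 0# to 𝟘; 1# to 𝟙)

  fromFin-to : ∀ x → fromFin (I.to x) ≈ x
  fromFin-to = I.strictlyInverseʳ

  fromFin-isRingMonomorphism : IsRingMonomorphism finRawRing rawRing fromFin
  fromFin-isRingMonomorphism = record
    { isRingHomomorphism = record
      { isSemiringHomomorphism = record
        { isNearSemiringHomomorphism = record
          { +-isMonoidHomomorphism = record
            { isMagmaHomomorphism = record
              { isRelHomomorphism = record { cong = λ { ≡.refl → refl } }
              ; homo = λ _ _ → fromFin-to _ }
            ; ε-homo = fromFin-to _ }
          ; *-homo = λ _ _ → fromFin-to _ }
        ; 1#-homo = fromFin-to _ }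
      ; -‿homo = λ _ → fromFin-to _ }
    ; injective = fromFin-injective }

  finField : IsField K → FinField N
  finField (1≉0 , invertible) = record
    { isCommutativeRing = RingMonomorphism.isCommutativeRing fromFin-isRingMonomorphism isCommutativeRing
    ; 1≢0 = λ 𝟙≡𝟘 → 1≉0 (trans (sym (fromFin-to 1#)) (trans (reflexive (≡.cong fromFin 𝟙≡𝟘)) (fromFin-to 0#)))
    ; inverse = inverse }
    where
    inverse : ∀ x → x ≢ 𝟘 → ∃ λ y → x ⊛ y ≡ 𝟙
    inverse x x≢𝟘 with invertible (fromFin x) (λ e → x≢𝟘 (fromFin-injective (trans e (sym (fromFin-to 0#)))))
    ... | y , xy≈1 = I.to y , fromFin-injective (begin
      fromFin (x ⊛ I.to y)          ≈⟨ fromFin-to _ ⟩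
      fromFin x * fromFin (I.to y)  ≈⟨ *-congˡ (fromFin-to y) ⟩
      fromFin x * y                 ≈⟨ xy≈1 ⟩
      1#                            ≈⟨ fromFin-to 1# ⟨
      fromFin 𝟙                     ∎)
      where open import Relation.Binary.Reasoning.Setoid setoid

  module _ (isField : IsField K) where
    open FieldOps (FinField.commutativeRing (finField isField)) using () renaming (_^_ to _^𝔽_; sum to sum𝔽)

    fromFin-^ : ∀ a e → fromFin (a ^𝔽 e) ≈ fromFin a ^ e
    fromFin-^ a zero    = fromFin-to 1#
    fromFin-^ a (suc e) = trans (fromFin-to _) (*-congˡ (fromFin-^ a e))

    fromFin-sum : ∀ {n} (f : Fin n → Fin N) → fromFin (sum𝔽 f) ≈ sum (λ i → fromFin (f i))
    fromFin-sum {zero}  f = fromFin-to 0#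
    fromFin-sum {suc n} f = trans (fromFin-to _) (+-congˡ (fromFin-sum (λ i → f (Fin.suc i))))

    fromFin-≉0 : ∀ {i} → i ≢ 𝟘 → ¬ (fromFin i ≈ 0#)
    fromFin-≉0 i≢𝟘 fromFin-i≈0 = i≢𝟘 (fromFin-injective (trans fromFin-i≈0 (sym (fromFin-to 0#))))

    fromFin-powSum≈0 : ∀ {n} (x : Fin n → Fin N) d → sum𝔽 (λ i → x i ^𝔽 d) ≡ 𝟘 →
                       powSum K (λ i → fromFin (x i)) d ≈ 0#
    fromFin-powSum≈0 {n} x d ∑≡𝟘 = begin
      sum (λ i → fromFin (x i) ^ d)     ≈⟨ sum-cong-≋ {n} (λ i → fromFin-^ (x i) d) ⟨
      sum (λ i → fromFin (x i ^𝔽 d))    ≈⟨ fromFin-sum (λ i → x i ^𝔽 d) ⟨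
      fromFin (sum𝔽 (λ i → x i ^𝔽 d))   ≡⟨ ≡.cong fromFin ∑≡𝟘 ⟩
      fromFin 𝟘                         ≈⟨ fromFin-to 0# ⟩
      0#                                ∎
      where
      open import Algebra.Properties.Monoid.Sum +-monoid using (sum-cong-≋)
      open import Relation.Binary.Reasoning.Setoid setoid

open import Data.Nat using (_+_; _*_; _^_; _∸_; _≤_; _<_)
open ≡ using (refl; cong; sym; trans; subst)

module _ {N} (F : FinField N) {p k m d : ℕ} (p-prime : Prime p) (1≤k : 1 ≤ k) (1≤m : 1 ≤ m)
         (N≡p^k : N ≡ p ^ k) (N∸1≡m*d : N ∸ 1 ≡ m * d) (m≢1 : m ≢ 1) (¬m≡2∧k≡1 : ¬ (m ≡ 2 × k ≡ 1)) where

  open FinFieldTheory F using (0#; 1#; fromℕ; nonzero; sum; 1+∣nonzero∣≡N; N≡p^k⇒fromℕ-p≡0; x+1≡0∧x≢1⇒1+1≢0)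
    renaming (_+_ to _⊕_; _*_ to _⊛_; _^_ to _^𝔽_)
  open NonzeroPowers F d
  open Cardinality

  private
    2≤p : 2 ≤ p
    2≤p = ℕ.nonTrivial⇒n>1 p {{prime⇒nonTrivial p-prime}}

    2≤N : 2 ≤ N
    2≤N = subst (2 ≤_) (sym N≡p^k)
            (ℕP.≤-trans 2≤p (subst (_≤ p ^ k) (ℕP.*-identityʳ p) (ℕP.^-monoʳ-≤ p {{prime⇒nonZero p-prime}} 1≤k)))

    ∣nonzero∣≡m*d : ∣ nonzero ∣ ≡ m * d
    ∣nonzero∣≡m*d = trans (cong (_∸ 1) 1+∣nonzero∣≡N) N∸1≡m*d

    1≤d : 1 ≤ d
    1≤d = ℕP.n≢0⇒n>0 λ d≡0 → ℕP.<⇒≱ 2≤N (ℕP.≤-reflexive (begin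
      N                   ≡⟨ 1+∣nonzero∣≡N ⟨
      suc ∣ nonzero ∣     ≡⟨ cong suc ∣nonzero∣≡m*d ⟩
      suc (m * d)         ≡⟨ cong (λ e → suc (m * e)) d≡0 ⟩
      suc (m * 0)         ≡⟨ cong suc (ℕP.*-zeroʳ m) ⟩
      1                   ∎))
      where open ≡.≡-Reasoning

    m≤∣H∣ : m ≤ ∣ H ∣
    m≤∣H∣ = ℕP.*-cancelˡ-≤ d {{ℕ.>-nonZero 1≤d}}
              (subst (_≤ d * ∣ H ∣) (trans ∣nonzero∣≡m*d (ℕP.*-comm m d)) (∣nonzero∣≤d*∣H∣ 1≤d))

    d<n⇒∣nonzero∣<n*∣H∣ : ∀ {n} → d < n → ∣ nonzero ∣ < n * ∣ H ∣
    d<n⇒∣nonzero∣<n*∣H∣ {n} d<n = begin-strict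
      ∣ nonzero ∣     ≡⟨ trans ∣nonzero∣≡m*d (ℕP.*-comm m d) ⟩
      d * m           <⟨ ℕP.*-monoˡ-< m {{ℕ.>-nonZero 1≤m}} d<n ⟩
      n * m           ≤⟨ ℕP.*-monoʳ-≤ n m≤∣H∣ ⟩
      n * ∣ H ∣       ∎
      where open ℕP.≤-Reasoning

  module _ (g²≡1 : ∀ {g} → g ∈ H → g ⊛ g ≡ 1#) where

    private
      m≡2 : m ≡ 2
      m≡2 = ℕP.≤-antisym (ℕP.≤-trans m≤∣H∣ (∣H∣≤2 g²≡1)) (ℕP.≤∧≢⇒< 1≤m (m≢1 ∘ sym))

      2≤∣H∣ : 2 ≤ ∣ H ∣
      2≤∣H∣ = subst (_≤ ∣ H ∣) m≡2 m≤∣H∣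

      2≤k : 2 ≤ k
      2≤k = ℕP.≤∧≢⇒< 1≤k (λ 1≡k → ¬m≡2∧k≡1 (m≡2 , sym 1≡k))

      fromℕ-p≡0 : fromℕ p ≡ 0#
      fromℕ-p≡0 = N≡p^k⇒fromℕ-p≡0 {p} {k} N≡p^k

      −1∈H : ∃ λ g → g ∈ H × g ≢ 1# × g ⊕ 1# ≡ 0#
      −1∈H = 2≤∣H∣⇒−1∈H g²≡1 2≤∣H∣

      0∈Sums2 : 0# ∈ Sums 2
      0∈Sums2 = let (g , g∈H , _ , g+1≡0) = −1∈H in −1∈H⇒0∈Sums2 g∈H g+1≡0

      p≢2 : p ≢ 2
      p≢2 p≡2 = let (g , _ , g≢1 , g+1≡0) = −1∈H in
        x+1≡0∧x≢1⇒1+1≢0 g+1≡0 g≢1 (subst (λ q → fromℕ q ≡ 0#) p≡2 fromℕ-p≡0)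

      p-odd : ∃ λ s → p ≡ suc (s + s)
      p-odd with even-or-odd p
      ... | s , inj₂ p≡1+s+s = s , p≡1+s+s
      ... | s , inj₁ p≡s+s = ⊥-elim ([ (λ ()) , p≢2 ∘ sym ]′ (prime⇒irreducible p-prime 2∣p))
        where
        2∣p : 2 ∣ p
        2∣p = divides s (trans p≡s+s (trans (cong (s +_) (sym (ℕP.+-identityʳ s))) (ℕP.*-comm 2 s)))

      p≤d : p ≤ d
      p≤d = ℕP.≤-pred (ℕP.*-cancelˡ-< 2 p (suc d) (begin-strict
        2 * p             ≤⟨ ℕP.*-monoˡ-≤ p 2≤p ⟩
        p * p             ≡⟨ cong (p *_) (ℕP.*-identityʳ p) ⟨
        p ^ 2             ≤⟨ ℕP.^-monoʳ-≤ p {{prime⇒nonZero p-prime}} 2≤k ⟩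
        p ^ k             ≡⟨ N≡p^k ⟨
        N                 ≡⟨ 1+∣nonzero∣≡N ⟨
        suc ∣ nonzero ∣   ≡⟨ cong suc (trans ∣nonzero∣≡m*d (cong (_* d) m≡2)) ⟩
        suc (2 * d)       <⟨ ℕP.n<1+n _ ⟩
        2 + 2 * d         ≡⟨ ℕP.*-suc 2 d ⟨
        2 * suc d         ∎))
        where open ℕP.≤-Reasoning

    H²≡1⇒0∈Sums[n] : ∀ {n} → d < n → 0# ∈ Sums n
    H²≡1⇒0∈Sums[n] {n} d<n = 0∈Sums2∧0∈Sums[1+2s]⇒0∈Sums {s} {n} 0∈Sums2
      (subst (λ q → 0# ∈ Sums q) p≡1+s+s (subst (_∈ Sums p) fromℕ-p≡0 (fromℕ[j]∈Sums[j] p)))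
      (subst (_≤ n) p≡1+s+s (ℕP.≤-trans p≤d (ℕP.<⇒≤ d<n)))
      where
      s : ℕ
      s = proj₁ p-odd
      p≡1+s+s : p ≡ suc (s + s)
      p≡1+s+s = proj₂ p-odd

  0∈Sums[n] : ∀ {n} → d < n → 0# ∈ Sums n
  0∈Sums[n] {n} d<n with FinP.any? (λ g → (H g Bool.≟ true) ×-dec ¬? (g ⊛ g FinP.≟ 1#))
  ... | yes (g₀ , g₀∈H , g₀²≢1) = ∣nonzero∣<n*∣H∣⇒0∈Sums g₀∈H g₀²≢1 n (d<n⇒∣nonzero∣<n*∣H∣ d<n)
  ... | no  ∄g₀                 = H²≡1⇒0∈Sums[n] g²≡1 d<n
    where
    g²≡1 : ∀ {g} → g ∈ H → g ⊛ g ≡ 1#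
    g²≡1 {g} g∈H = decidable-stable (g ⊛ g FinP.≟ 1#) (λ g²≢1 → ∄g₀ (g , g∈H , g²≢1))

  n-nonzero-powers-sum-to-0 : ∀ {n} → d < n →
                              ∃ λ (x : Fin n → Fin N) → (∀ i → x i ≢ 0#) × sum (λ i → x i ^𝔽 d) ≡ 0#
  n-nonzero-powers-sum-to-0 d<n = ∈Sums⇒sum-of-powers _ (0∈Sums[n] d<n)

theorem1p3 : ∀ {c ℓ} (p k m d : ℕ) → Prime p → 1 ≤ k → 1 ≤ m →
    (K : CommutativeRing c ℓ) → IsField K → HasCard K (p ^ k) →
    p ^ k ∸ 1 ≡ m * d →
    ¬ (m ≡ 1) → ¬ (m ≡ 2 × k ≡ 1) →
    (n : ℕ) → d < n →
    ∃ λ (x : Fin n → CommutativeRing.Carrier K) →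
      (∀ i → ¬ (CommutativeRing._≈_ K (x i) (CommutativeRing.0# K))) ×
      CommutativeRing._≈_ K (powSum K x d) (CommutativeRing.0# K)
theorem1p3 p k m d p-prime 1≤k 1≤m K isField card N∸1≡m*d m≢1 ¬m≡2∧k≡1 n d<n =
  let (x , x≢0 , ∑x^d≡0) = n-nonzero-powers-sum-to-0 (finField isField) p-prime 1≤k 1≤m refl N∸1≡m*d m≢1 ¬m≡2∧k≡1 d<n
  in (λ i → fromFin (x i)) , (λ i → fromFin-≉0 isField (x≢0 i)) , fromFin-powSum≈0 isField x d ∑x^d≡0
  where open FinFieldOfCard K card
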